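{- There is an absolute constant $C>0$ such that $R_3(H)\le C H\log H$ for all integers $H\ge 2$.
   Context: A polynomial $f\in\mathbb{C}[X]$ is degenerate if it has two distinct roots whose quotient is a root of unity. $S_3(H)$ is the set of monic polynomials $X^3+a_1X^2+a_2X+a_3\in\mathbb{Z}[X]$ that are degenerate with $|a_j|\le H$ for all $j$. $R_3(H)$ is the number of polynomials in $S_3(H)$ that are reducible in $\mathbb{Q}[X]$. -}

module Defs where

open import Level using (0ℓ)
open import Data.Nat as ℕ using (ℕ; zero; suc)
open import Data.Integer as ℤ using (ℤ; +_; -[1+_]; ∣_∣)
open import Data.Rational as ℚ using (ℚ)
open import Data.Fin using (Fin; toℕ)
open import Data.Vec using (Vec; lookup)
open import Data.List using (List; length)
open import Data.List.Relation.Unary.All using (All)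
open import Data.List.Relation.Unary.Unique.Propositional using (Unique)
open import Data.Product using (Σ; _×_; _,_; ∃; ∃-syntax)
open import Relation.Nullary using (¬_)
open import Relation.Binary.PropositionalEquality using (_≡_)
open import Algebra.Bundles using (CommutativeRing)

-- A monic integer cubic X^3 + a₁X^2 + a₂X + a₃ is represented by the
-- triple of its non-leading coefficients (a₁ , a₂ , a₃).

Cubic : Set
Cubic = ℤ × ℤ × ℤ

-- Fields of characteristic zero (stdlib has no Field bundle):
-- a commutative ring with 1 ≠ 0 in which every nonzero element has an
-- inverse, and in which n·1 ≠ 0 for every n ≥ 1.

natCast : (R : CommutativeRing 0ℓ 0ℓ) → ℕ → CommutativeRing.Carrier R
natCast R zero    = CommutativeRing.0# R
natCast R (suc n) = CommutativeRing._+_ R (CommutativeRing.1# R) (natCast R n)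

record Field0 : Set₁ where
  field
    cring      : CommutativeRing 0ℓ 0ℓ
  open CommutativeRing cring using (Carrier; _≈_; 0#; 1#; _*_)
  field
    nontrivial : ¬ (1# ≈ 0#)
    inverse    : ∀ x → ¬ (x ≈ 0#) → ∃[ y ] (x * y ≈ 1#)
    charZero   : ∀ n → natCast cring n ≈ 0# → n ≡ 0
  open CommutativeRing cring public

module _ (K : Field0) where
  open Field0 K hiding (zero)

  intCast : ℤ → Carrier
  intCast (+ n)    = natCast cring n
  intCast -[1+ n ] = - natCast cring (suc n)

  pow : Carrier → ℕ → Carrier
  pow x zero    = 1#
  pow x (suc n) = x * pow x n

  evalCubic : Cubic → Carrier → Carrier
  evalCubic (a₁ , a₂ , a₃) x =
    pow x 3 + intCast a₁ * pow x 2 + intCast a₂ * x + intCast a₃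

  -- α/β is a root of unity (β ≠ 0):  (α/β)^n = 1 for some n ≥ 1,
  -- written without division as α^n = β^n.
  RootOfUnityQuotient : Carrier → Carrier → Set
  RootOfUnityQuotient α β =
    ¬ (β ≈ 0#) × ∃[ n ] (1 ℕ.≤ n × pow α n ≈ pow β n)

-- Degenerate: f has two distinct roots (in an algebraically relevant
-- extension of ℚ, i.e. some field of characteristic zero; equivalently
-- in ℂ) whose quotient is a root of unity.

Degenerate : Cubic → Set₁
Degenerate f = Σ Field0 λ K → let open Field0 K in
  ∃[ α ] ∃[ β ] (¬ (α ≈ β) × evalCubic K f α ≈ 0# × evalCubic K f β ≈ 0#
                 × RootOfUnityQuotient K α β)

-- Polynomials over ℚ given by a coefficient vector of length d+1
-- (coefficient of X^i at position i), with nonzero leading coefficient.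

coeffV : ∀ {d} → Vec ℚ (suc d) → ℕ → ℚ
coeffV {d} v i with i ℕ.<? suc d
... | Relation.Nullary.yes i<d = lookup v (Data.Fin.fromℕ< i<d)
... | Relation.Nullary.no _    = ℚ.0ℚ

sumTo : ℕ → (ℕ → ℚ) → ℚ
sumTo zero    f = f zero
sumTo (suc k) f = sumTo k f ℚ.+ f (suc k)

coeffMul : (ℕ → ℚ) → (ℕ → ℚ) → ℕ → ℚ
coeffMul g h k = sumTo k (λ i → g i ℚ.* h (k ℕ.∸ i))

coeffCubic : Cubic → ℕ → ℚ
coeffCubic (a₁ , a₂ , a₃) 0 = a₃ ℚ./ 1
coeffCubic (a₁ , a₂ , a₃) 1 = a₂ ℚ./ 1
coeffCubic (a₁ , a₂ , a₃) 2 = a₁ ℚ./ 1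
coeffCubic (a₁ , a₂ , a₃) 3 = ℚ.1ℚ
coeffCubic (a₁ , a₂ , a₃) (suc (suc (suc (suc _)))) = ℚ.0ℚ

-- Reducible in ℚ[X]: f = g·h with g, h ∈ ℚ[X] both of degree ≥ 1.
ReducibleQ : Cubic → Set
ReducibleQ f =
  ∃[ d₁ ] ∃[ d₂ ] Σ (Vec ℚ (suc (suc d₁))) λ g → Σ (Vec ℚ (suc (suc d₂))) λ h →
    ¬ (coeffV g (suc d₁) ≡ ℚ.0ℚ) × ¬ (coeffV h (suc d₂) ≡ ℚ.0ℚ) ×
    (∀ k → coeffMul (coeffV g) (coeffV h) k ≡ coeffCubic f k)

Bounded : ℕ → Cubic → Set
Bounded H (a₁ , a₂ , a₃) = ∣ a₁ ∣ ℕ.≤ H × ∣ a₂ ∣ ℕ.≤ H × ∣ a₃ ∣ ℕ.≤ H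

-- membership in S₃(H) and reducibility: the polynomials counted by R₃(H)
CountedR3 : ℕ → Cubic → Set₁
CountedR3 H f = Bounded H f × Degenerate f × ReducibleQ f

-- A reducible monic cubic f has an integer root r, so f = (X - r) (X² + b X + c). Let α ≠ β be
-- roots with α^N = β^N. A rational root x ≠ r with x^N = r^N must be -r, and then
-- f = (X + a₁) (X² + a₂). Otherwise two distinct roots x, y of X² + b X + c (α and β, or one of
-- them and its conjugate) have x^N = y^N; then x^(2N) + y^(2N) = 2 c^N, and a Niven-type argument on the
-- Lucas sequence of x², y² gives b² = k c with 0 ≤ k ≤ 3. So f is (X + a₁) (X² + a₂) with
-- |a₁|, |a₂|, |a₁ a₂| ≤ H, or (X - r) (X² + b X + b²/k) with |r|, |b|, |r b| ≤ 3H: in both cases it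
-- is determined by a lattice point under the hyperbola |x y| ≤ 3H, and there are O(H log H) of those.

module Submission where

open import Defs
open import Data.Nat as ℕ using (ℕ; zero; suc; z≤n; s≤s)
import Data.Nat.Properties as ℕP
import Data.Nat.Divisibility as ℕD
open import Data.Nat.GCD using (gcd; gcd[m,n]∣m; gcd[m,n]∣n; gcd-greatest)
open import Data.Nat.Coprimality as Coprimality using (Coprime; coprime-divisor)
open import Data.Nat.DivMod using (_/_; m/n*n≤m; m/n≤m; m*n/n≡m; /-monoˡ-≤)
open import Data.Nat.Logarithm using (⌊log₂_⌋; ⌊log₂⌋-mono-≤; ⌊log₂[2^n]⌋≡n; ⌊log₂[2*b]⌋≡1+⌊log₂b⌋)
import Data.Nat.Tactic.RingSolver as ℕSolver
open import Data.Integer as ℤ using (ℤ; +_; -[1+_]; ∣_∣; _⊖_; _◃_; sign; 0ℤ; 1ℤ)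
import Data.Integer.Properties as ℤP
open import Data.Integer.Divisibility.Signed as ℤD using (divides; ∣ᵤ⇒∣; ∣⇒∣ᵤ)
import Data.Integer.GCD as ℤGCD
import Data.Integer.Tactic.RingSolver as ℤSolver
open import Data.Sign as Sign using (Sign)
open import Data.Rational as ℚ using (ℚ; mkℚ; 0ℚ; 1ℚ)
import Data.Rational.Properties as ℚP
open import Data.Rational.Unnormalised as ℚᵘ using (mkℚᵘ; *≡*)
import Data.Rational.Unnormalised.Properties as ℚᵘP
open import Data.Fin using (Fin; zero; suc; toℕ; #_)
open import Data.Fin.Properties using (any?)
open import Data.Vec using (Vec; _∷_; [])
open import Data.List using (List; []; _∷_; _++_; map; length; upTo; cartesianProductWith; cartesianProduct)
import Data.List.Properties as List
open import Data.List.Membership.Propositional using (_∈_)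
open import Data.List.Membership.Propositional.Properties
  using (∈-map⁺; ∈-++⁺ˡ; ∈-++⁺ʳ; ∈-upTo⁺; ∈-cartesianProduct⁺; ∈-cartesianProductWith⁺)
open import Data.List.Relation.Unary.Any using (here; there; _─_)
open import Data.List.Relation.Unary.All as All using (All)
open import Data.List.Relation.Unary.AllPairs using (_∷_)
open import Data.List.Relation.Unary.Unique.Propositional using (Unique)
open import Data.List.Relation.Binary.Subset.Propositional using (_⊆_)
open import Data.Maybe using (Maybe; just; nothing)
open import Data.Product using (Σ; ∃-syntax; _×_; _,_; proj₁; proj₂)
open import Data.Sum using (_⊎_; inj₁; inj₂; [_,_]′)
open import Function using (id)
open import Relation.Nullary using (¬_; Dec; yes; no)
open import Relation.Nullary.Decidable using (_⊎-dec_; ¬¬-excluded-middle; decidable-stable)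
open import Relation.Nullary.Negation using (contradiction; ¬¬-map)
open import Relation.Binary.Definitions using (tri<; tri≈; tri>)
import Relation.Binary.PropositionalEquality as ≡
import Algebra.Solver.Ring
import Algebra.Solver.Ring.AlmostCommutativeRing as ACR

-- Lucas sequences and a Niven-type bound

module _ where
  open ≡ using (_≡_; _≢_; refl; sym; trans; cong; cong₂; subst; subst₂; module ≡-Reasoning)
  open import Data.Integer.Base using (_+_; _*_; -_; _-_; _^_) renaming (NonZero to ℤNonZero)

  coprime∧∣^⇒≡1 : ∀ {m n} → Coprime m n → ∀ j → m ℕD.∣ n ℕ.^ j → m ≡ 1
  coprime∧∣^⇒≡1 cop zero    m∣1   = ℕD.∣1⇒≡1 m∣1
  coprime∧∣^⇒≡1 cop (suc j) m∣n^j = coprime∧∣^⇒≡1 cop j (coprime-divisor cop m∣n^j)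

  ∣i^n∣≡∣i∣^n : ∀ i n → ∣ i ^ n ∣ ≡ ∣ i ∣ ℕ.^ n
  ∣i^n∣≡∣i∣^n i zero    = refl
  ∣i^n∣≡∣i∣^n i (suc n) = trans (ℤP.∣i*j∣≡∣i∣*∣j∣ i (i ^ n)) (cong (∣ i ∣ ℕ.*_) (∣i^n∣≡∣i∣^n i n))

  ^-distribʳ-* : ∀ i j n → (i * j) ^ n ≡ i ^ n * j ^ n
  ^-distribʳ-* i j zero    = refl
  ^-distribʳ-* i j (suc n) = trans (cong (i * j *_) (^-distribʳ-* i j n)) (interchange i j (i ^ n) (j ^ n))
    where
    interchange : ∀ i j p q → i * j * (p * q) ≡ i * p * (j * q)
    interchange = ℤSolver.solve-∀

  ∣i∣≡∣j∣⇒i≡j⊎i≡-j : ∀ i j → ∣ i ∣ ≡ ∣ j ∣ → i ≡ j ⊎ i ≡ - j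
  ∣i∣≡∣j∣⇒i≡j⊎i≡-j (+ m)    (+ n)    eq   = inj₁ (cong +_ eq)
  ∣i∣≡∣j∣⇒i≡j⊎i≡-j (+ m)    -[1+ n ] eq   = inj₂ (cong +_ eq)
  ∣i∣≡∣j∣⇒i≡j⊎i≡-j -[1+ m ] (+ _)    refl = inj₂ refl
  ∣i∣≡∣j∣⇒i≡j⊎i≡-j -[1+ m ] -[1+ _ ] refl = inj₁ refl

  i^[1+n]≡j^[1+n]⇒i≡j⊎i≡-j : ∀ i j n → i ^ suc n ≡ j ^ suc n → i ≡ j ⊎ i ≡ - j
  i^[1+n]≡j^[1+n]⇒i≡j⊎i≡-j i j n eq = ∣i∣≡∣j∣⇒i≡j⊎i≡-j i j ∣i∣≡∣j∣
    where
    ∣i∣^N≡∣j∣^N : ∣ i ∣ ℕ.^ suc n ≡ ∣ j ∣ ℕ.^ suc n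
    ∣i∣^N≡∣j∣^N = trans (sym (∣i^n∣≡∣i∣^n i (suc n))) (trans (cong ∣_∣ eq) (∣i^n∣≡∣i∣^n j (suc n)))
    ∣i∣≡∣j∣ : ∣ i ∣ ≡ ∣ j ∣
    ∣i∣≡∣j∣ with ℕP.<-cmp ∣ i ∣ ∣ j ∣
    ... | tri< lt _ _ = contradiction ∣i∣^N≡∣j∣^N (ℕP.<⇒≢ (ℕP.^-monoˡ-< (suc n) lt))
    ... | tri≈ _ eq _ = eq
    ... | tri> _ _ gt = contradiction (sym ∣i∣^N≡∣j∣^N) (ℕP.<⇒≢ (ℕP.^-monoˡ-< (suc n) gt))

  ∣i∣≡1⇒i*i≡1 : ∀ i → ∣ i ∣ ≡ 1 → i * i ≡ 1ℤ
  ∣i∣≡1⇒i*i≡1 (+ 1)            _ = refl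
  ∣i∣≡1⇒i*i≡1 -[1+ 0 ]         _ = refl
  ∣i∣≡1⇒i*i≡1 (+ 0)            ()
  ∣i∣≡1⇒i*i≡1 (+ suc (suc _))  ()
  ∣i∣≡1⇒i*i≡1 -[1+ suc _ ]     ()

  -- With m = x² + y² and c = x y one has lucasV m c k = x^(2k) + y^(2k).
  lucasV : ℤ → ℤ → ℕ → ℤ
  lucasV m c zero          = + 2
  lucasV m c (suc zero)    = m
  lucasV m c (suc (suc k)) = m * lucasV m c (suc k) - c * c * lucasV m c k

  lucasV-homogeneous : ∀ m c g k → lucasV (m * g) (c * g) k ≡ g ^ k * lucasV m c k
  lucasV-homogeneous m c g zero          = refl
  lucasV-homogeneous m c g (suc zero)    = comm m g
    where
    comm : ∀ m g → m * g ≡ g * 1ℤ * m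
    comm = ℤSolver.solve-∀
  lucasV-homogeneous m c g (suc (suc k)) = trans
    (cong₂ (λ u v → m * g * u - c * g * (c * g) * v)
           (lucasV-homogeneous m c g (suc k)) (lucasV-homogeneous m c g k))
    (shift g (g ^ k) m c (lucasV m c (suc k)) (lucasV m c k))
    where
    shift : ∀ g gᵏ m c v₁ v₀ → m * g * (g * gᵏ * v₁) - c * g * (c * g) * (gᵏ * v₀)
                                ≡ g * (g * gᵏ) * (m * v₁ - c * c * v₀)
    shift = ℤSolver.solve-∀

  lucasV≡^-mod : ∀ m c k → c ℤD.∣ lucasV m c (suc k) - m ^ suc k
  lucasV≡^-mod m c zero       = divides 0ℤ (identity m c)
    where
    identity : ∀ m c → m - m * 1ℤ ≡ 0ℤ * c
    identity = ℤSolver.solve-∀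
  lucasV≡^-mod m c (suc zero) = divides (- (c * + 2)) (identity m c)
    where
    identity : ∀ m c → m * m - c * c * + 2 - m * (m * 1ℤ) ≡ - (c * + 2) * c
    identity = ℤSolver.solve-∀
  lucasV≡^-mod m c (suc (suc k)) with lucasV≡^-mod m c (suc k)
  ... | divides q eq = divides (m * q - c * lucasV m c (suc k)) (begin
    lucasV m c (suc (suc (suc k))) - m ^ suc (suc (suc k))
      ≡⟨ regroup m c _ (lucasV m c (suc k)) (m ^ suc (suc k)) ⟩
    m * (lucasV m c (suc (suc k)) - m ^ suc (suc k)) - c * c * lucasV m c (suc k)
      ≡⟨ cong (λ u → m * u - c * c * lucasV m c (suc k)) eq ⟩
    m * (q * c) - c * c * lucasV m c (suc k)
      ≡⟨ factor m c q (lucasV m c (suc k)) ⟩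
    (m * q - c * lucasV m c (suc k)) * c ∎)
    where
    open ≡-Reasoning
    regroup : ∀ m c v₂ v₁ p → m * v₂ - c * c * v₁ - m * p ≡ m * (v₂ - p) - c * c * v₁
    regroup = ℤSolver.solve-∀
    factor : ∀ m c q v₁ → m * (q * c) - c * c * v₁ ≡ (m * q - c * v₁) * c
    factor = ℤSolver.solve-∀

  module _ {m c : ℤ} (c*c≡1 : c * c ≡ 1ℤ) (3≤∣m∣ : 3 ℕ.≤ ∣ m ∣) where

    -- With c² = 1 the recurrence reads V(k+2) = m V(k+1) - V k, and |m| ≥ 3 forces growth.
    ∣lucasV∣-increasing : ∀ k → ∣ lucasV m c k ∣ ℕ.< ∣ lucasV m c (suc k) ∣
    ∣lucasV∣-increasing zero    = 3≤∣m∣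
    ∣lucasV∣-increasing (suc k) = ℕP.≰⇒> λ v₂≤v₁ →
      ℕP.<⇒≱ (ℕP.+-mono-≤-< v₂≤v₁ (∣lucasV∣-increasing k)) (ℕP.≤-trans 2v₁≤3v₁ 3v₁≤v₂+v₀)
      where
      v₀ = lucasV m c k
      v₁ = lucasV m c (suc k)
      v₂ = lucasV m c (suc (suc k))
      m*v₁≡v₂+v₀ : m * v₁ ≡ v₂ + v₀
      m*v₁≡v₂+v₀ = trans (rearrange m v₁ v₀) (cong (λ u → m * v₁ - u * v₀ + v₀) (sym c*c≡1))
        where
        rearrange : ∀ m v₁ v₀ → m * v₁ ≡ m * v₁ - 1ℤ * v₀ + v₀
        rearrange = ℤSolver.solve-∀
      3v₁≤v₂+v₀ : 3 ℕ.* ∣ v₁ ∣ ℕ.≤ ∣ v₂ ∣ ℕ.+ ∣ v₀ ∣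
      3v₁≤v₂+v₀ = ℕP.≤-trans (ℕP.*-monoˡ-≤ ∣ v₁ ∣ 3≤∣m∣)
        (subst (ℕ._≤ ∣ v₂ ∣ ℕ.+ ∣ v₀ ∣) (trans (cong ∣_∣ (sym m*v₁≡v₂+v₀)) (ℤP.∣i*j∣≡∣i∣*∣j∣ m v₁))
               (ℤP.∣i+j∣≤∣i∣+∣j∣ v₂ v₀))
      2v₁≤3v₁ : ∣ v₁ ∣ ℕ.+ ∣ v₁ ∣ ℕ.≤ 3 ℕ.* ∣ v₁ ∣
      2v₁≤3v₁ = ℕP.+-monoʳ-≤ ∣ v₁ ∣ (ℕP.m≤m+n ∣ v₁ ∣ _)

    2<∣lucasV∣ : ∀ k → 2 ℕ.< ∣ lucasV m c (suc k) ∣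
    2<∣lucasV∣ zero    = ∣lucasV∣-increasing zero
    2<∣lucasV∣ (suc k) = ℕP.<-trans (2<∣lucasV∣ k) (∣lucasV∣-increasing (suc k))

  coprime∧lucasV≡2dᴺ⇒∣d∣≡1∧∣a∣≤2 : ∀ a d n → Coprime ∣ d ∣ ∣ a ∣ → lucasV a d (suc n) ≡ + 2 * d ^ suc n →
                   ∣ d ∣ ≡ 1 × ∣ a ∣ ℕ.≤ 2
  coprime∧lucasV≡2dᴺ⇒∣d∣≡1∧∣a∣≤2 a d n cop V≡2dᴺ = ∣d∣≡1 , ∣a∣≤2
    where
    N = suc n
    d∣V : d ℤD.∣ lucasV a d N
    d∣V = divides (+ 2 * d ^ n) (trans V≡2dᴺ (reorder d (d ^ n)))
      where
      reorder : ∀ d dⁿ → + 2 * (d * dⁿ) ≡ + 2 * dⁿ * d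
      reorder = ℤSolver.solve-∀
    d∣aᴺ : d ℤD.∣ a ^ N
    d∣aᴺ = subst (d ℤD.∣_) (difference (lucasV a d N) (a ^ N))
                 (ℤD.∣m∣n⇒∣m-n d∣V (lucasV≡^-mod a d n))
      where
      difference : ∀ v p → v - (v - p) ≡ p
      difference = ℤSolver.solve-∀
    ∣d∣≡1 : ∣ d ∣ ≡ 1
    ∣d∣≡1 = coprime∧∣^⇒≡1 cop N (subst (∣ d ∣ ℕD.∣_) (∣i^n∣≡∣i∣^n a N) (∣⇒∣ᵤ d∣aᴺ))
    ∣V∣≡2 : ∣ lucasV a d N ∣ ≡ 2
    ∣V∣≡2 = begin
      ∣ lucasV a d N ∣       ≡⟨ cong ∣_∣ V≡2dᴺ ⟩
      ∣ + 2 * d ^ N ∣        ≡⟨ ℤP.∣i*j∣≡∣i∣*∣j∣ (+ 2) (d ^ N) ⟩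
      2 ℕ.* ∣ d ^ N ∣        ≡⟨ cong (2 ℕ.*_) (∣i^n∣≡∣i∣^n d N) ⟩
      2 ℕ.* ∣ d ∣ ℕ.^ N      ≡⟨ cong (λ k → 2 ℕ.* k ℕ.^ N) ∣d∣≡1 ⟩
      2 ℕ.* 1 ℕ.^ N          ≡⟨ cong (2 ℕ.*_) (ℕP.^-zeroˡ N) ⟩
      2                      ∎
      where open ≡-Reasoning
    ∣a∣≤2 : ∣ a ∣ ℕ.≤ 2
    ∣a∣≤2 with 3 ℕP.≤? ∣ a ∣
    ... | yes 3≤∣a∣ = contradiction (sym ∣V∣≡2) (ℕP.<⇒≢ (2<∣lucasV∣ (∣i∣≡1⇒i*i≡1 d ∣d∣≡1) 3≤∣a∣ n))
    ... | no  3≰∣a∣ = ℕP.≤-pred (ℕP.≰⇒> 3≰∣a∣)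

  coprime-quotients : ∀ m c → c ≢ 0ℤ →
    ∃[ g ] ∃[ a ] ∃[ d ] (ℕ.NonZero g × m ≡ a * + g × c ≡ d * + g × Coprime ∣ d ∣ ∣ a ∣)
  coprime-quotients m c c≢0 = g , ℤD.quotient g∣m , ℤD.quotient g∣c , g≢0 , m≡a*g , c≡d*g , coprime
    where
    g = gcd ∣ m ∣ ∣ c ∣
    g∣m : + g ℤD.∣ m
    g∣m = ∣ᵤ⇒∣ (gcd[m,n]∣m ∣ m ∣ ∣ c ∣)
    g∣c : + g ℤD.∣ c
    g∣c = ∣ᵤ⇒∣ (gcd[m,n]∣n ∣ m ∣ ∣ c ∣)
    a = ℤD.quotient g∣m
    d = ℤD.quotient g∣c
    m≡a*g : m ≡ a * + g
    m≡a*g = ℤD._∣_.equality g∣m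
    c≡d*g : c ≡ d * + g
    c≡d*g = ℤD._∣_.equality g∣c
    g≢0 : ℕ.NonZero g
    g≢0 = ℕ.≢-nonZero λ g≡0 → c≢0 (trans c≡d*g (trans (cong (λ k → d * + k) g≡0) (ℤP.*-zeroʳ d)))
    coprime : Coprime ∣ d ∣ ∣ a ∣
    coprime {k} (k∣d , k∣a) =
      ℕD.∣1⇒≡1 (ℕD.*-cancelʳ-∣ g {{g≢0}} (subst (k ℕ.* g ℕD.∣_) (sym (ℕP.*-identityˡ g)) kg∣g))
      where
      kg∣ : ∀ {x y} → x ≡ y * + g → k ℕD.∣ ∣ y ∣ → k ℕ.* g ℕD.∣ ∣ x ∣
      kg∣ {x} {y} x≡ k∣y = subst (k ℕ.* g ℕD.∣_) (sym (trans (cong ∣_∣ x≡) (ℤP.∣i*j∣≡∣i∣*∣j∣ y (+ g))))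
                                 (ℕD.*-monoˡ-∣ g k∣y)
      kg∣g : k ℕ.* g ℕD.∣ g
      kg∣g = gcd-greatest (kg∣ {m} {a} m≡a*g k∣a) (kg∣ {c} {d} c≡d*g k∣d)

  -- After dividing m and c by their gcd, c = ±1 and |m| ≤ 2 by the growth of the sequence.
  lucasV≡2cᴺ⇒m≡t*c : ∀ m c n → c ≢ 0ℤ → lucasV m c (suc n) ≡ + 2 * c ^ suc n →
                      ∃[ t ] m ≡ t * c × ∣ t ∣ ℕ.≤ 2
  lucasV≡2cᴺ⇒m≡t*c m c n c≢0 V≡2cᴺ with coprime-quotients m c c≢0
  ... | g , a , d , g≢0 , m≡a*g , c≡d*g , coprime = a * d , m≡ad*c , ∣ad∣≤2
    where
    N = suc n
    gᴺ≢0 : ℤNonZero ((+ g) ^ N)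
    gᴺ≢0 = subst ℕ.NonZero (sym (∣i^n∣≡∣i∣^n (+ g) N)) (ℕP.m^n≢0 g N {{g≢0}})
    V[a,d]≡2dᴺ : lucasV a d N ≡ + 2 * d ^ N
    V[a,d]≡2dᴺ = ℤP.*-cancelˡ-≡ ((+ g) ^ N) _ _ {{gᴺ≢0}} (begin
      (+ g) ^ N * lucasV a d N      ≡⟨ sym (lucasV-homogeneous a d (+ g) N) ⟩
      lucasV (a * + g) (d * + g) N  ≡⟨ subst₂ (λ x y → lucasV x y N ≡ + 2 * y ^ N) m≡a*g c≡d*g V≡2cᴺ ⟩
      + 2 * (d * + g) ^ N           ≡⟨ cong (+ 2 *_) (^-distribʳ-* d (+ g) N) ⟩
      + 2 * (d ^ N * (+ g) ^ N)     ≡⟨ reorder (d ^ N) ((+ g) ^ N) ⟩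
      (+ g) ^ N * (+ 2 * d ^ N)     ∎)
      where
      open ≡-Reasoning
      reorder : ∀ p q → + 2 * (p * q) ≡ q * (+ 2 * p)
      reorder = ℤSolver.solve-∀
    reduced = coprime∧lucasV≡2dᴺ⇒∣d∣≡1∧∣a∣≤2 a d n coprime V[a,d]≡2dᴺ
    ∣d∣≡1 = proj₁ reduced
    m≡ad*c : m ≡ a * d * c
    m≡ad*c = begin
      m                  ≡⟨ m≡a*g ⟩
      a * + g            ≡⟨ sym (ℤP.*-identityʳ (a * + g)) ⟩
      a * + g * 1ℤ       ≡⟨ cong (a * + g *_) (sym (∣i∣≡1⇒i*i≡1 d ∣d∣≡1)) ⟩
      a * + g * (d * d)  ≡⟨ reorder a (+ g) d ⟩
      a * d * (d * + g)  ≡⟨ cong (a * d *_) (sym c≡d*g) ⟩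
      a * d * c          ∎
      where
      open ≡-Reasoning
      reorder : ∀ a g d → a * g * (d * d) ≡ a * d * (d * g)
      reorder = ℤSolver.solve-∀
    ∣ad∣≤2 : ∣ a * d ∣ ℕ.≤ 2
    ∣ad∣≤2 = subst (ℕ._≤ 2)
      (sym (trans (ℤP.∣i*j∣≡∣i∣*∣j∣ a d) (trans (cong (∣ a ∣ ℕ.*_) ∣d∣≡1) (ℕP.*-identityʳ ∣ a ∣))))
      (proj₂ reduced)

  evalℤ : Cubic → ℤ → ℤ
  evalℤ (a₁ , a₂ , a₃) x = x * x * x + a₁ * (x * x) + a₂ * x + a₃

  -- If r is a root of f then f = (X - r) (X² + b X + c) with (b , c) = cofactor f r.
  cofactor : Cubic → ℤ → ℤ × ℤ
  cofactor (a₁ , a₂ , a₃) r = a₁ + r , a₂ + r * (a₁ + r)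

  QuadraticShape : ℤ × ℤ → Set
  QuadraticShape (b , c) = Σ (Fin 4) λ k → b * b ≡ + toℕ k * c

  quadraticShape? : ∀ q → Dec (QuadraticShape q)
  quadraticShape? (b , c) = any? λ k → b * b ℤ.≟ + toℕ k * c

  DegenerateShape : Cubic → ℤ → Set
  DegenerateShape f@(a₁ , a₂ , a₃) r = a₃ ≡ a₁ * a₂ ⊎ QuadraticShape (cofactor f r)

  degenerateShape? : ∀ f r → Dec (DegenerateShape f r)
  degenerateShape? f@(a₁ , a₂ , a₃) r = (a₃ ℤ.≟ a₁ * a₂) ⊎-dec quadraticShape? (cofactor f r)

  quadraticShape-from-lucas : ∀ b c t → b * b - + 2 * c ≡ t * c → ∣ t ∣ ℕ.≤ 2 →
                              b * b ≢ + 4 * c → QuadraticShape (b , c)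
  quadraticShape-from-lucas b c t m≡tc ∣t∣≤2 b²≢4c = shape t ∣t∣≤2 b*b≡[t+2]*c
    where
    b*b≡[t+2]*c : b * b ≡ (t + + 2) * c
    b*b≡[t+2]*c = trans (shift b c) (trans (cong (_+ + 2 * c) m≡tc) (factor t c))
      where
      shift : ∀ b c → b * b ≡ b * b - + 2 * c + + 2 * c
      shift = ℤSolver.solve-∀
      factor : ∀ t c → t * c + + 2 * c ≡ (t + + 2) * c
      factor = ℤSolver.solve-∀
    shape : ∀ t → ∣ t ∣ ℕ.≤ 2 → b * b ≡ (t + + 2) * c → QuadraticShape (b , c)
    shape -[1+ 1 ] _ eq = # 0 , eq
    shape -[1+ 0 ] _ eq = # 1 , eq
    shape (+ 0)    _ eq = # 2 , eq
    shape (+ 1)    _ eq = # 3 , eq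
    shape (+ 2)    _ eq = contradiction eq b²≢4c
    shape (+ suc (suc (suc _))) (s≤s (s≤s ())) _
    shape -[1+ suc (suc _) ]    (s≤s (s≤s ())) _

  -- X^k ≡ p X + q modulo X² + b X + c, where (p , q) = powerRemainder b c k.
  powerRemainder : ℤ → ℤ → ℕ → ℤ × ℤ
  powerRemainder b c zero    = 0ℤ , 1ℤ
  powerRemainder b c (suc k) = let (p , q) = powerRemainder b c k in q - b * p , - (c * p)

  -- Multiplying the roots of f by d.
  rescale : Cubic → ℤ → Cubic
  rescale (a₁ , a₂ , a₃) d = a₁ * d , a₂ * (d * d) , a₃ * (d * d * d)

  -- The rational root theorem: n / (d + 1) in lowest terms is a root only if d = 0.
  rescaled-root⇒root : ∀ f n d → Coprime (suc d) ∣ n ∣ → evalℤ (rescale f (+ suc d)) n ≡ 0ℤ →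
                       evalℤ f n ≡ 0ℤ
  rescaled-root⇒root f@(a₁ , a₂ , a₃) n d coprime root with d≡0
    where
    D = + suc d
    d∣n³ : D ℤD.∣ n ^ 3
    d∣n³ = divides q (trans (expand a₁ a₂ a₃ n D) (trans (cong (_+ q * D) root) (ℤP.+-identityˡ (q * D))))
      where
      q = - (a₁ * (n * n) + a₂ * n * D + a₃ * (D * D))
      expand : ∀ a₁ a₂ a₃ n D → n * (n * (n * 1ℤ)) ≡
        n * n * n + a₁ * D * (n * n) + a₂ * (D * D) * n + a₃ * (D * D * D)
          + - (a₁ * (n * n) + a₂ * n * D + a₃ * (D * D)) * D
      expand = ℤSolver.solve-∀
    d≡0 : d ≡ 0
    d≡0 = ℕP.suc-injective (coprime∧∣^⇒≡1 coprime 3 (subst (suc d ℕD.∣_) (∣i^n∣≡∣i∣^n n 3) (∣⇒∣ᵤ d∣n³)))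
  ... | refl = trans (unit-rescale a₁ a₂ a₃ n) root
    where
    unit-rescale : ∀ a₁ a₂ a₃ n → n * n * n + a₁ * (n * n) + a₂ * n + a₃ ≡
      n * n * n + a₁ * 1ℤ * (n * n) + a₂ * (1ℤ * 1ℤ) * n + a₃ * (1ℤ * 1ℤ * 1ℤ)
    unit-rescale = ℤSolver.solve-∀

-- Roots of integer cubics in a field of characteristic zero

module FieldTheory (K : Field0) where
  open Field0 K hiding (zero)
  open import Algebra.Properties.Ring ring using (-‿distribˡ-*; -‿distribʳ-*)
  open import Algebra.Properties.AbelianGroup +-abelianGroup using (⁻¹-∙-comm)
  open import Algebra.Properties.Group +-group
    using (⁻¹-involutive; ε⁻¹≈ε; x∙y⁻¹≈ε⇒x≈y; x≈y⇒x∙y⁻¹≈ε; inverseˡ-unique)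
  open import Algebra.Properties.CommutativeSemigroup *-commutativeSemigroup
    using () renaming (interchange to *-interchange)
  open import Relation.Binary.Reasoning.Setoid setoid

  ιℕ : ℕ → Carrier
  ιℕ = natCast cring

  ι : ℤ → Carrier
  ι = intCast K

  ιℕ-+ : ∀ m n → ιℕ (m ℕ.+ n) ≈ ιℕ m + ιℕ n
  ιℕ-+ zero    n = sym (+-identityˡ _)
  ιℕ-+ (suc m) n = trans (+-congˡ (ιℕ-+ m n)) (sym (+-assoc _ _ _))

  ιℕ-* : ∀ m n → ιℕ (m ℕ.* n) ≈ ιℕ m * ιℕ n
  ιℕ-* zero    n = sym (zeroˡ _)
  ιℕ-* (suc m) n = begin
    ιℕ (n ℕ.+ m ℕ.* n)        ≈⟨ ιℕ-+ n (m ℕ.* n) ⟩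
    ιℕ n + ιℕ (m ℕ.* n)       ≈⟨ +-cong (sym (*-identityˡ _)) (ιℕ-* m n) ⟩
    1# * ιℕ n + ιℕ m * ιℕ n   ≈⟨ sym (distribʳ _ _ _) ⟩
    (1# + ιℕ m) * ιℕ n        ∎

  ι-⊖ : ∀ m n → ι (m ⊖ n) ≈ ιℕ m - ιℕ n
  ι-⊖ zero    zero    = sym (-‿inverseʳ 0#)
  ι-⊖ zero    (suc n) = sym (+-identityˡ _)
  ι-⊖ (suc m) zero    = sym (trans (+-congˡ ε⁻¹≈ε) (+-identityʳ _))
  ι-⊖ (suc m) (suc n) rewrite ℤP.[1+m]⊖[1+n]≡m⊖n m n = begin
    ι (m ⊖ n)                          ≈⟨ ι-⊖ m n ⟩
    ιℕ m - ιℕ n                        ≈⟨ sym (+-identityˡ _) ⟩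
    0# + (ιℕ m - ιℕ n)                 ≈⟨ +-congʳ (sym (-‿inverseʳ 1#)) ⟩
    (1# - 1#) + (ιℕ m - ιℕ n)          ≈⟨ +-assoc _ _ _ ⟩
    1# + (- 1# + (ιℕ m - ιℕ n))        ≈⟨ +-congˡ (sym (+-assoc _ _ _)) ⟩
    1# + ((- 1# + ιℕ m) - ιℕ n)        ≈⟨ +-congˡ (+-congʳ (+-comm _ _)) ⟩
    1# + ((ιℕ m - 1#) - ιℕ n)          ≈⟨ +-congˡ (+-assoc _ _ _) ⟩
    1# + (ιℕ m + (- 1# - ιℕ n))        ≈⟨ +-congˡ (+-congˡ (⁻¹-∙-comm _ _)) ⟩
    1# + (ιℕ m - (1# + ιℕ n))          ≈⟨ sym (+-assoc _ _ _) ⟩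
    (1# + ιℕ m) - (1# + ιℕ n)          ∎

  ι-neg : ∀ z → ι (ℤ.- z) ≈ - ι z
  ι-neg (+ zero)  = sym ε⁻¹≈ε
  ι-neg (+ suc n) = refl
  ι-neg -[1+ n ]  = sym (⁻¹-involutive _)

  ι-+ : ∀ x y → ι (x ℤ.+ y) ≈ ι x + ι y
  ι-+ (+ m)    (+ n)    = ιℕ-+ m n
  ι-+ (+ m)    -[1+ n ] = ι-⊖ m (suc n)
  ι-+ -[1+ m ] (+ n)    = trans (ι-⊖ n (suc m)) (+-comm _ _)
  ι-+ -[1+ m ] -[1+ n ] = begin
    - ιℕ (suc (suc (m ℕ.+ n)))    ≈⟨ -‿cong (reflexive (≡.cong ιℕ (≡.sym (ℕP.+-suc (suc m) n)))) ⟩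
    - ιℕ (suc m ℕ.+ suc n)        ≈⟨ -‿cong (ιℕ-+ (suc m) (suc n)) ⟩
    - (ιℕ (suc m) + ιℕ (suc n))   ≈⟨ sym (⁻¹-∙-comm _ _) ⟩
    - ιℕ (suc m) - ιℕ (suc n)     ∎

  ι-- : ∀ x y → ι (x ℤ.- y) ≈ ι x - ι y
  ι-- x y = trans (ι-+ x (ℤ.- y)) (+-congˡ (ι-neg y))

  signCast : Sign → Carrier
  signCast Sign.+ = 1#
  signCast Sign.- = - 1#

  signCast-* : ∀ s t → signCast (s Sign.* t) ≈ signCast s * signCast t
  signCast-* Sign.+ Sign.+ = sym (*-identityˡ _)
  signCast-* Sign.+ Sign.- = sym (*-identityˡ _)
  signCast-* Sign.- Sign.+ = sym (*-identityʳ _)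
  signCast-* Sign.- Sign.- = begin
    1#              ≈⟨ sym (⁻¹-involutive _) ⟩
    - - 1#          ≈⟨ -‿cong (sym (*-identityʳ _)) ⟩
    - (- 1# * 1#)   ≈⟨ -‿distribʳ-* _ _ ⟩
    - 1# * - 1#     ∎

  ι-◃ : ∀ s n → ι (s ◃ n) ≈ signCast s * ιℕ n
  ι-◃ s       zero    = sym (zeroʳ _)
  ι-◃ Sign.+ (suc n) = sym (*-identityˡ _)
  ι-◃ Sign.- (suc n) = trans (-‿cong (sym (*-identityˡ _))) (-‿distribˡ-* _ _)

  ι≈sign*abs : ∀ z → ι z ≈ signCast (sign z) * ιℕ ∣ z ∣
  ι≈sign*abs (+ n)    = sym (*-identityˡ _)
  ι≈sign*abs -[1+ n ] = trans (-‿cong (sym (*-identityˡ _))) (-‿distribˡ-* _ _)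

  ι-* : ∀ x y → ι (x ℤ.* y) ≈ ι x * ι y
  ι-* x y = begin
    ι (x ℤ.* y)                                     ≈⟨ ι-◃ (sign x Sign.* sign y) (∣ x ∣ ℕ.* ∣ y ∣) ⟩
    signCast (sign x Sign.* sign y) * ιℕ (∣ x ∣ ℕ.* ∣ y ∣)
                                                    ≈⟨ *-cong (signCast-* (sign x) (sign y)) (ιℕ-* ∣ x ∣ ∣ y ∣) ⟩
    (sx * sy) * (ιℕ ∣ x ∣ * ιℕ ∣ y ∣)              ≈⟨ *-interchange sx sy (ιℕ ∣ x ∣) (ιℕ ∣ y ∣) ⟩
    (sx * ιℕ ∣ x ∣) * (sy * ιℕ ∣ y ∣)              ≈⟨ *-cong (sym (ι≈sign*abs x)) (sym (ι≈sign*abs y)) ⟩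
    ι x * ι y                                       ∎
    where
    sx = signCast (sign x)
    sy = signCast (sign y)

  ι-1 : ι 1ℤ ≈ 1#
  ι-1 = +-identityʳ 1#

  ι-morphism : ℤ.+-*-rawRing ACR.-Raw-AlmostCommutative⟶ ACR.fromCommutativeRing cring
  ι-morphism = record
    { ⟦_⟧ = ι ; +-homo = ι-+ ; *-homo = ι-* ; -‿homo = ι-neg ; 0-homo = refl ; 1-homo = ι-1 }

  ι-≟ : ∀ a b → Maybe (ι a ≈ ι b)
  ι-≟ a b with a ℤ.≟ b
  ... | yes ≡.refl = just refl
  ... | no _       = nothing

  open Algebra.Solver.Ring ℤ.+-*-rawRing (ACR.fromCommutativeRing cring) ι-morphism ι-≟ public
    using (solve; _:+_; _:*_; :-_; _:-_; _:=_; con)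

  ι≈0⇒≡0 : ∀ z → ι z ≈ 0# → z ≡.≡ 0ℤ
  ι≈0⇒≡0 (+ n)    ιz≈0 = ≡.cong +_ (charZero n ιz≈0)
  ι≈0⇒≡0 -[1+ n ] ιz≈0 with charZero (suc n) (trans (sym (⁻¹-involutive _)) (trans (-‿cong ιz≈0) ε⁻¹≈ε))
  ... | ()

  ι-injective : ∀ {x y} → ι x ≈ ι y → x ≡.≡ y
  ι-injective {x} {y} ιx≈ιy = ℤP.i-j≡0⇒i≡j x y (ι≈0⇒≡0 (x ℤ.- y) (trans (ι-- x y) (x≈y⇒x∙y⁻¹≈ε ιx≈ιy)))

  ι-≉0 : ∀ {z} → z ≡.≢ 0ℤ → ¬ ι z ≈ 0#
  ι-≉0 {z} z≢0 ιz≈0 = z≢0 (ι≈0⇒≡0 z ιz≈0)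

  infixr 8 _^_
  _^_ : Carrier → ℕ → Carrier
  _^_ = pow K

  ι-^ : ∀ z n → ι (z ℤ.^ n) ≈ ι z ^ n
  ι-^ z zero    = ι-1
  ι-^ z (suc n) = trans (ι-* z (z ℤ.^ n)) (*-congˡ (ι-^ z n))

  ^-congˡ : ∀ {x y} n → x ≈ y → x ^ n ≈ y ^ n
  ^-congˡ zero    x≈y = refl
  ^-congˡ (suc n) x≈y = *-cong x≈y (^-congˡ n x≈y)

  ^-distrib-* : ∀ x y n → (x * y) ^ n ≈ x ^ n * y ^ n
  ^-distrib-* x y zero    = sym (*-identityˡ 1#)
  ^-distrib-* x y (suc n) = trans (*-congˡ (^-distrib-* x y n)) (*-interchange x y (x ^ n) (y ^ n))

  x*y≈0⇒y≈0 : ∀ {x y} → ¬ x ≈ 0# → x * y ≈ 0# → y ≈ 0#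
  x*y≈0⇒y≈0 {x} {y} x≉0 xy≈0 with inverse x x≉0
  ... | x⁻¹ , x*x⁻¹≈1 = begin
    y              ≈⟨ sym (*-identityˡ y) ⟩
    1# * y         ≈⟨ *-congʳ (sym x*x⁻¹≈1) ⟩
    (x * x⁻¹) * y  ≈⟨ *-congʳ (*-comm x x⁻¹) ⟩
    (x⁻¹ * x) * y  ≈⟨ *-assoc x⁻¹ x y ⟩
    x⁻¹ * (x * y)  ≈⟨ *-congˡ xy≈0 ⟩
    x⁻¹ * 0#       ≈⟨ zeroʳ x⁻¹ ⟩
    0#             ∎

  *-≉0 : ∀ {x y} → ¬ x ≈ 0# → ¬ y ≈ 0# → ¬ x * y ≈ 0#
  *-≉0 x≉0 y≉0 xy≈0 = y≉0 (x*y≈0⇒y≈0 x≉0 xy≈0)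

  ^-≉0 : ∀ {x} n → ¬ x ≈ 0# → ¬ x ^ n ≈ 0#
  ^-≉0 zero    x≉0 = nontrivial
  ^-≉0 (suc n) x≉0 = *-≉0 x≉0 (^-≉0 n x≉0)

  x≈0⇒x^[1+n]≈0 : ∀ {x} n → x ≈ 0# → x ^ suc n ≈ 0#
  x≈0⇒x^[1+n]≈0 n x≈0 = trans (*-congʳ x≈0) (zeroˡ _)

  x^[1+n]≈y^[1+n]⇒x≉0 : ∀ {x y} n → x ^ suc n ≈ y ^ suc n → ¬ y ≈ 0# → ¬ x ≈ 0#
  x^[1+n]≈y^[1+n]⇒x≉0 n xᴺ≈yᴺ y≉0 x≈0 = ^-≉0 (suc n) y≉0 (trans (sym xᴺ≈yᴺ) (x≈0⇒x^[1+n]≈0 n x≈0))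

  *-≈0ʳ : ∀ x {y} → y ≈ 0# → x * y ≈ 0#
  *-≈0ʳ x y≈0 = trans (*-congˡ y≈0) (zeroʳ x)

  *-≈0ˡ : ∀ {x} y → x ≈ 0# → x * y ≈ 0#
  *-≈0ˡ y x≈0 = trans (*-congʳ x≈0) (zeroˡ y)

  +-≈0 : ∀ {x y} → x ≈ 0# → y ≈ 0# → x + y ≈ 0#
  +-≈0 x≈0 y≈0 = trans (+-cong x≈0 y≈0) (+-identityʳ 0#)

  −-≈0 : ∀ {x y} → x ≈ 0# → y ≈ 0# → x - y ≈ 0#
  −-≈0 x≈0 y≈0 = trans (+-cong x≈0 (trans (-‿cong y≈0) ε⁻¹≈ε)) (+-identityʳ 0#)

  x-y≈0⇒x≈y : ∀ {x y} → x - y ≈ 0# → x ≈ y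
  x-y≈0⇒x≈y = x∙y⁻¹≈ε⇒x≈y _ _

  x≈y⇒x-y≈0 : ∀ {x y} → x ≈ y → x - y ≈ 0#
  x≈y⇒x-y≈0 = x≈y⇒x∙y⁻¹≈ε

  2≉0 : ¬ ι (+ 2) ≈ 0#
  2≉0 2≈0 with charZero 2 2≈0
  ... | ()

  quadratic : Carrier → Carrier → Carrier → Carrier
  quadratic B C x = x * x + B * x + C

  vieta : ∀ {B C x y} → quadratic B C x ≈ 0# → quadratic B C y ≈ 0# → ¬ x ≈ y →
          x + y + B ≈ 0# × C ≈ x * y
  vieta {B} {C} {x} {y} qx≈0 qy≈0 x≉y = sum≈0 , C≈xy
    where
    sum≈0 : x + y + B ≈ 0#
    sum≈0 = x*y≈0⇒y≈0 (λ x-y≈0 → x≉y (x-y≈0⇒x≈y x-y≈0))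
      (trans (solve 4 (λ x y B C → (x :- y) :* (x :+ y :+ B) :=
                                   (x :* x :+ B :* x :+ C) :- (y :* y :+ B :* y :+ C)) refl x y B C)
             (−-≈0 qx≈0 qy≈0))
    C≈xy : C ≈ x * y
    C≈xy = x-y≈0⇒x≈y
      (trans (solve 4 (λ x y B C → C :- x :* y := (x :* x :+ B :* x :+ C) :- x :* (x :+ y :+ B)) refl x y B C)
             (−-≈0 qx≈0 (*-≈0ʳ x sum≈0)))

  ι-lucasV : ∀ {m c x y} → ι m ≈ x * x + y * y → ι c ≈ x * y →
             ∀ k → ι (lucasV m c k) ≈ (x * x) ^ k + (y * y) ^ k
  ι-lucasV m≈ c≈ zero          = +-congˡ (+-identityʳ 1#)
  ι-lucasV m≈ c≈ (suc zero)    = trans m≈ (sym (+-cong (*-identityʳ _) (*-identityʳ _)))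
  ι-lucasV {m} {c} {x} {y} m≈ c≈ (suc (suc k)) = x-y≈0⇒x≈y (begin
    ι (lucasV m c (suc (suc k))) - (x * x * (x * x * p) + y * y * (y * y * q))
      ≈⟨ +-congʳ (trans (ι-- (m ℤ.* v₁) (c ℤ.* c ℤ.* v₀))
                        (+-cong (ι-* m v₁) (-‿cong (trans (ι-* (c ℤ.* c) v₀) (*-congʳ (ι-* c c)))))) ⟩
    (ι m * ι (lucasV m c (suc k)) - ι c * ι c * ι (lucasV m c k)) - (x * x * (x * x * p) + y * y * (y * y * q))
      ≈⟨ +-congʳ (+-cong (*-congˡ (ι-lucasV m≈ c≈ (suc k))) (-‿cong (*-congˡ (ι-lucasV m≈ c≈ k)))) ⟩
    (ι m * (x * x * p + y * y * q) - ι c * ι c * (p + q)) - (x * x * (x * x * p) + y * y * (y * y * q))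
      ≈⟨ solve 6 (λ M C x y p q →
           M :* (x :* x :* p :+ y :* y :* q) :- C :* C :* (p :+ q) :- (x :* x :* (x :* x :* p) :+ y :* y :* (y :* y :* q))
           := (M :- (x :* x :+ y :* y)) :* (x :* x :* p :+ y :* y :* q) :- (C :- x :* y) :* (C :+ x :* y) :* (p :+ q))
         refl (ι m) (ι c) x y p q ⟩
    (ι m - (x * x + y * y)) * (x * x * p + y * y * q) - (ι c - x * y) * (ι c + x * y) * (p + q)
      ≈⟨ −-≈0 (*-≈0ˡ _ (x≈y⇒x-y≈0 m≈)) (*-≈0ˡ _ (*-≈0ˡ _ (x≈y⇒x-y≈0 c≈))) ⟩
    0# ∎)
    where
    v₀ = lucasV m c k
    v₁ = lucasV m c (suc k)
    p = (x * x) ^ k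
    q = (y * y) ^ k

  -- x and y are the roots of X² + b X + c, so x²,y² are those of X² - (b² - 2c) X + c²; when
  -- x^N = y^N the power sums x^(2N) + y^(2N) equal 2 c^N, which pins b² - 2c down to a few multiples of c.
  quadratic-degenerate : ∀ b c {x y} n → quadratic (ι b) (ι c) x ≈ 0# → quadratic (ι b) (ι c) y ≈ 0# →
                         ¬ x ≈ y → ¬ y ≈ 0# → x ^ suc n ≈ y ^ suc n → QuadraticShape (b , c)
  quadratic-degenerate b c {x} {y} n qx≈0 qy≈0 x≉y y≉0 xᴺ≈yᴺ =
    let (t , m≡tc , ∣t∣≤2) = lucasV≡2cᴺ⇒m≡t*c m c n c≢0 (ι-injective ι-lucasV≈2cᴺ)
    in  quadraticShape-from-lucas b c t m≡tc ∣t∣≤2 b²≢4c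
    where
    N = suc n
    B = ι b
    C = ι c
    m = b ℤ.* b ℤ.- + 2 ℤ.* c
    sum≈0 : x + y + B ≈ 0#
    sum≈0 = proj₁ (vieta qx≈0 qy≈0 x≉y)
    C≈xy : C ≈ x * y
    C≈xy = proj₂ (vieta qx≈0 qy≈0 x≉y)
    c≢0 : c ≡.≢ 0ℤ
    c≢0 c≡0 = *-≉0 (x^[1+n]≈y^[1+n]⇒x≉0 n xᴺ≈yᴺ y≉0) y≉0
                   (trans (sym C≈xy) (reflexive (≡.cong ι c≡0)))
    ιm≈x²+y² : ι m ≈ x * x + y * y
    ιm≈x²+y² = trans (trans (ι-- (b ℤ.* b) (+ 2 ℤ.* c)) (+-cong (ι-* b b) (-‿cong (ι-* (+ 2) c))))
      (x-y≈0⇒x≈y (trans (solve 4 (λ x y B C →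
          B :* B :- con (+ 2) :* C :- (x :* x :+ y :* y) :=
          (x :+ y :+ B) :* (B :- x :- y) :- con (+ 2) :* (C :- x :* y)) refl x y B C)
        (−-≈0 (*-≈0ˡ _ sum≈0) (*-≈0ʳ _ (x≈y⇒x-y≈0 C≈xy)))))
    ι-lucasV≈2cᴺ : ι (lucasV m c N) ≈ ι (+ 2 ℤ.* c ℤ.^ N)
    ι-lucasV≈2cᴺ = begin
      ι (lucasV m c N)               ≈⟨ ι-lucasV ιm≈x²+y² C≈xy N ⟩
      (x * x) ^ N + (y * y) ^ N      ≈⟨ +-cong (^-distrib-* x x N) (^-distrib-* y y N) ⟩
      X * X + Y * Y                  ≈⟨ x-y≈0⇒x≈y (trans (solve 2 (λ X Y →
                                          X :* X :+ Y :* Y :- con (+ 2) :* (X :* Y) := (X :- Y) :* (X :- Y))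
                                          refl X Y) (*-≈0ˡ _ (x≈y⇒x-y≈0 xᴺ≈yᴺ))) ⟩
      ι (+ 2) * (X * Y)              ≈⟨ *-congˡ (sym (^-distrib-* x y N)) ⟩
      ι (+ 2) * (x * y) ^ N          ≈⟨ *-congˡ (sym (^-congˡ N C≈xy)) ⟩
      ι (+ 2) * C ^ N                ≈⟨ sym (trans (ι-* (+ 2) (c ℤ.^ N)) (*-congˡ (ι-^ c N))) ⟩
      ι (+ 2 ℤ.* c ℤ.^ N)            ∎
      where
      X = x ^ N
      Y = y ^ N
    b²≢4c : b ℤ.* b ≡.≢ + 4 ℤ.* c
    b²≢4c b²≡4c = *-≉0 x-y≉0 x-y≉0 (trans (solve 4 (λ x y B C →
        (x :- y) :* (x :- y) := (B :* B :- con (+ 4) :* C) :- (x :+ y :+ B) :* ((x :+ y :+ B) :- con (+ 2) :* (x :+ y))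
                                :+ con (+ 4) :* (C :- x :* y)) refl x y B C)
        (+-≈0 (−-≈0 (x≈y⇒x-y≈0 B²≈4C) (*-≈0ˡ _ sum≈0)) (*-≈0ʳ _ (x≈y⇒x-y≈0 C≈xy))))
      where
      x-y≉0 : ¬ x - y ≈ 0#
      x-y≉0 x-y≈0 = x≉y (x-y≈0⇒x≈y x-y≈0)
      B²≈4C : B * B ≈ ι (+ 4) * C
      B²≈4C = trans (sym (ι-* b b)) (trans (reflexive (≡.cong ι b²≡4c)) (ι-* (+ 4) c))

  rational∧x^N≈r^N⇒x+r≈0 : ∀ a e r {x} n → a ≡.≢ 0ℤ → ι a * x ≈ ι e → x ^ suc n ≈ ι r ^ suc n →
                            ¬ x ≈ ι r → x + ι r ≈ 0#
  rational∧x^N≈r^N⇒x+r≈0 a e r {x} n a≢0 ax≈e xᴺ≈rᴺ x≉r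
    with i^[1+n]≡j^[1+n]⇒i≡j⊎i≡-j e (a ℤ.* r) n (ι-injective eᴺ≈[ar]ᴺ)
    where
    eᴺ≈[ar]ᴺ : ι (e ℤ.^ suc n) ≈ ι ((a ℤ.* r) ℤ.^ suc n)
    eᴺ≈[ar]ᴺ = begin
      ι (e ℤ.^ suc n)              ≈⟨ ι-^ e (suc n) ⟩
      ι e ^ suc n                  ≈⟨ ^-congˡ (suc n) (sym ax≈e) ⟩
      (ι a * x) ^ suc n            ≈⟨ ^-distrib-* (ι a) x (suc n) ⟩
      ι a ^ suc n * x ^ suc n      ≈⟨ *-congˡ xᴺ≈rᴺ ⟩
      ι a ^ suc n * ι r ^ suc n    ≈⟨ sym (^-distrib-* (ι a) (ι r) (suc n)) ⟩
      (ι a * ι r) ^ suc n          ≈⟨ ^-congˡ (suc n) (sym (ι-* a r)) ⟩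
      ι (a ℤ.* r) ^ suc n          ≈⟨ sym (ι-^ (a ℤ.* r) (suc n)) ⟩
      ι ((a ℤ.* r) ℤ.^ suc n)      ∎
  ... | inj₁ e≡ar  = contradiction (x-y≈0⇒x≈y (x*y≈0⇒y≈0 (ι-≉0 a≢0) (begin
    ι a * (x - ι r)        ≈⟨ solve 3 (λ a x r → a :* (x :- r) := a :* x :- a :* r) refl (ι a) x (ι r) ⟩
    ι a * x - ι a * ι r    ≈⟨ +-cong ax≈e (-‿cong (sym (ι-* a r))) ⟩
    ι e - ι (a ℤ.* r)      ≈⟨ x≈y⇒x-y≈0 (reflexive (≡.cong ι e≡ar)) ⟩
    0#                     ∎))) x≉r
  ... | inj₂ e≡-ar = x*y≈0⇒y≈0 (ι-≉0 a≢0) (begin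
    ι a * (x + ι r)        ≈⟨ distribˡ _ _ _ ⟩
    ι a * x + ι a * ι r    ≈⟨ +-cong ax≈e (sym (ι-* a r)) ⟩
    ι e + ι (a ℤ.* r)      ≈⟨ +-congʳ (trans (reflexive (≡.cong ι e≡-ar)) (ι-neg (a ℤ.* r))) ⟩
    - ι (a ℤ.* r) + ι (a ℤ.* r) ≈⟨ -‿inverseˡ _ ⟩
    0#                     ∎)

  ^≈powerRemainder : ∀ b c {z} → quadratic (ι b) (ι c) z ≈ 0# → ∀ k →
                     z ^ k ≈ ι (proj₁ (powerRemainder b c k)) * z + ι (proj₂ (powerRemainder b c k))
  ^≈powerRemainder b c {z} qz≈0 zero    = sym (trans (+-congʳ (zeroˡ z)) (trans (+-identityˡ _) (+-identityʳ 1#)))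
  ^≈powerRemainder b c {z} qz≈0 (suc k) = x-y≈0⇒x≈y (begin
    z * z ^ k - (ι (q ℤ.- b ℤ.* p) * z + ι (ℤ.- (c ℤ.* p)))
      ≈⟨ +-cong (*-congˡ (^≈powerRemainder b c qz≈0 k))
                (-‿cong (+-cong (*-congʳ (trans (ι-- q (b ℤ.* p)) (+-congˡ (-‿cong (ι-* b p)))))
                                (trans (ι-neg (c ℤ.* p)) (-‿cong (ι-* c p))))) ⟩
    z * (ι p * z + ι q) - ((ι q - ι b * ι p) * z + - (ι c * ι p))
      ≈⟨ solve 5 (λ z P Q B C → z :* (P :* z :+ Q) :- ((Q :- B :* P) :* z :+ (:- (C :* P)))
                                := P :* (z :* z :+ B :* z :+ C)) refl z (ι p) (ι q) (ι b) (ι c) ⟩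
    ι p * quadratic (ι b) (ι c) z
      ≈⟨ *-≈0ʳ (ι p) qz≈0 ⟩
    0# ∎)
    where
    p = proj₁ (powerRemainder b c k)
    q = proj₂ (powerRemainder b c k)

  cubic : Cubic → Carrier → Carrier
  cubic (a₁ , a₂ , a₃) x = x * x * x + ι a₁ * (x * x) + ι a₂ * x + ι a₃

  evalCubic≈cubic : ∀ f x → evalCubic K f x ≈ cubic f x
  evalCubic≈cubic (a₁ , a₂ , a₃) x = +-congʳ (+-congʳ (+-cong x³ (*-congˡ x²)))
    where
    x² : x ^ 2 ≈ x * x
    x² = *-congˡ (*-identityʳ x)
    x³ : x ^ 3 ≈ x * x * x
    x³ = trans (*-congˡ x²) (sym (*-assoc x x x))

  cubic-cong : ∀ f {x y} → x ≈ y → cubic f x ≈ cubic f y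
  cubic-cong f x≈y = +-congʳ (+-cong (+-cong (*-cong (*-cong x≈y x≈y) x≈y) (*-congˡ (*-cong x≈y x≈y)))
                                     (*-congˡ x≈y))

  ι-evalℤ : ∀ f x → ι (evalℤ f x) ≈ cubic f (ι x)
  ι-evalℤ (a₁ , a₂ , a₃) x = begin
    ι (x³ ℤ.+ a₁x² ℤ.+ a₂ ℤ.* x ℤ.+ a₃)            ≈⟨ ι-+ (x³ ℤ.+ a₁x² ℤ.+ a₂ ℤ.* x) a₃ ⟩
    ι (x³ ℤ.+ a₁x² ℤ.+ a₂ ℤ.* x) + ι a₃            ≈⟨ +-congʳ (ι-+ (x³ ℤ.+ a₁x²) (a₂ ℤ.* x)) ⟩
    ι (x³ ℤ.+ a₁x²) + ι (a₂ ℤ.* x) + ι a₃          ≈⟨ +-congʳ (+-cong (ι-+ x³ a₁x²) (ι-* a₂ x)) ⟩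
    ι x³ + ι a₁x² + ι a₂ * ι x + ι a₃              ≈⟨ +-congʳ (+-congʳ (+-cong ι-x³ ι-a₁x²)) ⟩
    ι x * ι x * ι x + ι a₁ * (ι x * ι x) + ι a₂ * ι x + ι a₃ ∎
    where
    x³ = x ℤ.* x ℤ.* x
    a₁x² = a₁ ℤ.* (x ℤ.* x)
    ι-x³ : ι x³ ≈ ι x * ι x * ι x
    ι-x³ = trans (ι-* (x ℤ.* x) x) (*-congʳ (ι-* x x))
    ι-a₁x² : ι a₁x² ≈ ι a₁ * (ι x * ι x)
    ι-a₁x² = trans (ι-* a₁ (x ℤ.* x)) (*-congˡ (ι-* x x))

  cubic-rescale : ∀ f d x → cubic (rescale f d) (ι d * x) ≈ ι d * ι d * ι d * cubic f x
  cubic-rescale f@(a₁ , a₂ , a₃) d x = begin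
    cubic (rescale f d) (D * x)
      ≈⟨ +-cong (+-cong (+-congˡ (*-congʳ (ι-* a₁ d))) (*-congʳ ιa₂d²)) ιa₃d³ ⟩
    (D * x) * (D * x) * (D * x) + ι a₁ * D * ((D * x) * (D * x)) + ι a₂ * (D * D) * (D * x) + ι a₃ * (D * D * D)
      ≈⟨ solve 5 (λ A₁ A₂ A₃ D x →
           (D :* x) :* (D :* x) :* (D :* x) :+ A₁ :* D :* ((D :* x) :* (D :* x)) :+ A₂ :* (D :* D) :* (D :* x)
             :+ A₃ :* (D :* D :* D)
           := D :* D :* D :* (x :* x :* x :+ A₁ :* (x :* x) :+ A₂ :* x :+ A₃)) refl (ι a₁) (ι a₂) (ι a₃) D x ⟩
    D * D * D * cubic f x ∎
    where
    D = ι d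
    ιa₂d² : ι (a₂ ℤ.* (d ℤ.* d)) ≈ ι a₂ * (D * D)
    ιa₂d² = trans (ι-* a₂ (d ℤ.* d)) (*-congˡ (ι-* d d))
    ιa₃d³ : ι (a₃ ℤ.* (d ℤ.* d ℤ.* d)) ≈ ι a₃ * (D * D * D)
    ιa₃d³ = trans (ι-* a₃ (d ℤ.* d ℤ.* d)) (*-congˡ (trans (ι-* (d ℤ.* d) d) (*-congʳ (ι-* d d))))

  cubic-factor : ∀ f r → evalℤ f r ≡.≡ 0ℤ → let (b , c) = cofactor f r in
                 ∀ x → cubic f x ≈ (x - ι r) * quadratic (ι b) (ι c) x
  cubic-factor f@(a₁ , a₂ , a₃) r fr≡0 x = x-y≈0⇒x≈y (begin
    cubic f x - (x - R) * quadratic (ι (a₁ ℤ.+ r)) (ι (a₂ ℤ.+ r ℤ.* (a₁ ℤ.+ r))) x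
      ≈⟨ +-congˡ (-‿cong (*-congˡ (+-cong (+-congˡ (*-congʳ ιb)) ιc))) ⟩
    cubic f x - (x - R) * (x * x + (A₁ + R) * x + (A₂ + R * (A₁ + R)))
      ≈⟨ solve 5 (λ A₁ A₂ A₃ R x →
           x :* x :* x :+ A₁ :* (x :* x) :+ A₂ :* x :+ A₃
             :- (x :- R) :* (x :* x :+ (A₁ :+ R) :* x :+ (A₂ :+ R :* (A₁ :+ R)))
           := R :* R :* R :+ A₁ :* (R :* R) :+ A₂ :* R :+ A₃) refl A₁ A₂ (ι a₃) R x ⟩
    cubic f R
      ≈⟨ sym (ι-evalℤ f r) ⟩
    ι (evalℤ f r)
      ≈⟨ reflexive (≡.cong ι fr≡0) ⟩
    0# ∎)
    where
    A₁ = ι a₁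
    A₂ = ι a₂
    R = ι r
    ιb : ι (a₁ ℤ.+ r) ≈ A₁ + R
    ιb = ι-+ a₁ r
    ιc : ι (a₂ ℤ.+ r ℤ.* (a₁ ℤ.+ r)) ≈ A₂ + R * (A₁ + R)
    ιc = trans (ι-+ a₂ _) (+-congˡ (trans (ι-* r _) (*-congˡ ιb)))

  cubic-±root : ∀ a₁ a₂ a₃ {x} → let f = (a₁ , a₂ , a₃) in
                cubic f x ≈ 0# → cubic f (- x) ≈ 0# → ¬ x ≈ 0# → a₃ ≡.≡ a₁ ℤ.* a₂
  cubic-±root a₁ a₂ a₃ {x} fx≈0 f[-x]≈0 x≉0 =
    ι-injective (x-y≈0⇒x≈y (begin
      A₃ - ι (a₁ ℤ.* a₂)                    ≈⟨ +-congˡ (-‿cong (ι-* a₁ a₂)) ⟩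
      A₃ - A₁ * A₂                          ≈⟨ solve 4 (λ A₁ A₂ A₃ x →
                                                 A₃ :- A₁ :* A₂ := (A₁ :* (x :* x) :+ A₃) :- A₁ :* (x :* x :+ A₂))
                                                 refl A₁ A₂ A₃ x ⟩
      (A₁ * (x * x) + A₃) - A₁ * (x * x + A₂) ≈⟨ −-≈0 even≈0 (*-≈0ʳ A₁ odd≈0) ⟩
      0#                                    ∎))
    where
    A₁ = ι a₁
    A₂ = ι a₂
    A₃ = ι a₃
    odd≈0 : x * x + A₂ ≈ 0#
    odd≈0 = x*y≈0⇒y≈0 (*-≉0 2≉0 x≉0) (trans (solve 4 (λ A₁ A₂ A₃ x →
        con (+ 2) :* x :* (x :* x :+ A₂) :=
        (x :* x :* x :+ A₁ :* (x :* x) :+ A₂ :* x :+ A₃) :-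
        ((:- x) :* (:- x) :* (:- x) :+ A₁ :* ((:- x) :* (:- x)) :+ A₂ :* (:- x) :+ A₃)) refl A₁ A₂ A₃ x)
      (−-≈0 fx≈0 f[-x]≈0))
    even≈0 : A₁ * (x * x) + A₃ ≈ 0#
    even≈0 = x*y≈0⇒y≈0 2≉0 (trans (solve 4 (λ A₁ A₂ A₃ x →
        con (+ 2) :* (A₁ :* (x :* x) :+ A₃) :=
        (x :* x :* x :+ A₁ :* (x :* x) :+ A₂ :* x :+ A₃) :+
        ((:- x) :* (:- x) :* (:- x) :+ A₁ :* ((:- x) :* (:- x)) :+ A₂ :* (:- x) :+ A₃)) refl A₁ A₂ A₃ x)
      (+-≈0 fx≈0 f[-x]≈0))

  module _ (f : Cubic) (r : ℤ) (fr≡0 : evalℤ f r ≡.≡ 0ℤ) where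
    private
      b = proj₁ (cofactor f r)
      c = proj₂ (cofactor f r)
      R = ι r

    cofactor-root : ∀ {x} → cubic f x ≈ 0# → ¬ x ≈ R → quadratic (ι b) (ι c) x ≈ 0#
    cofactor-root {x} fx≈0 x≉R = x*y≈0⇒y≈0 (λ x-R≈0 → x≉R (x-y≈0⇒x≈y x-R≈0))
                                           (trans (sym (cubic-factor f r fr≡0 x)) fx≈0)

    cofactor-root⇒root : ∀ {x} → quadratic (ι b) (ι c) x ≈ 0# → cubic f x ≈ 0#
    cofactor-root⇒root {x} qx≈0 = trans (cubic-factor f r fr≡0 x) (*-≈0ʳ _ qx≈0)

    root+R≈0⇒shape : ∀ {x} → cubic f x ≈ 0# → x + R ≈ 0# → ¬ R ≈ 0# → DegenerateShape f r
    root+R≈0⇒shape {x} fx≈0 x+R≈0 R≉0 =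
      inj₁ (cubic-±root (proj₁ f) (proj₁ (proj₂ f)) (proj₂ (proj₂ f)) fR≈0 f[-R]≈0 R≉0)
      where
      fR≈0 : cubic f R ≈ 0#
      fR≈0 = trans (sym (ι-evalℤ f r)) (reflexive (≡.cong ι fr≡0))
      f[-R]≈0 : cubic f (- R) ≈ 0#
      f[-R]≈0 = trans (cubic-cong f (sym (inverseˡ-unique x R x+R≈0))) fx≈0

    -- A root x ≠ r of the cofactor with x^N = r^N is either rational, hence -r, or irrational, and
    -- then its conjugate -b - x has the same N-th power (both equal the remainder of X^N).
    cofactor-root∧x^N≈r^N⇒shape : ∀ {x} n → quadratic (ι b) (ι c) x ≈ 0# → ¬ x ≈ R →
                                  x ^ suc n ≈ R ^ suc n → ¬ R ≈ 0# → ¬ ¬ DegenerateShape f r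
    cofactor-root∧x^N≈r^N⇒shape {x} n qx≈0 x≉R xᴺ≈rᴺ R≉0 with proj₁ (powerRemainder b c (suc n)) ℤ.≟ 0ℤ
    ... | no p≢0 = λ ¬shape → ¬shape (root+R≈0⇒shape (cofactor-root⇒root qx≈0)
        (rational∧x^N≈r^N⇒x+r≈0 p (r ℤ.^ suc n ℤ.- q) r n p≢0 px≈rᴺ-q xᴺ≈rᴺ x≉R) R≉0)
      where
      p = proj₁ (powerRemainder b c (suc n))
      q = proj₂ (powerRemainder b c (suc n))
      px≈rᴺ-q : ι p * x ≈ ι (r ℤ.^ suc n ℤ.- q)
      px≈rᴺ-q = begin
        ι p * x                     ≈⟨ solve 2 (λ u v → u := (u :+ v) :- v) refl (ι p * x) (ι q) ⟩
        (ι p * x + ι q) - ι q       ≈⟨ +-congʳ (sym (^≈powerRemainder b c qx≈0 (suc n))) ⟩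
        x ^ suc n - ι q             ≈⟨ +-congʳ (trans xᴺ≈rᴺ (sym (ι-^ r (suc n)))) ⟩
        ι (r ℤ.^ suc n) - ι q       ≈⟨ sym (ι-- (r ℤ.^ suc n) q) ⟩
        ι (r ℤ.^ suc n ℤ.- q)       ∎
    ... | yes p≡0 = ¬¬-map conjugate ¬¬-excluded-middle
      where
      q = proj₂ (powerRemainder b c (suc n))
      x' = - ι b - x
      qx'≈0 : quadratic (ι b) (ι c) x' ≈ 0#
      qx'≈0 = trans (solve 3 (λ x B C → (:- B :- x) :* (:- B :- x) :+ B :* (:- B :- x) :+ C
                                       := x :* x :+ B :* x :+ C) refl x (ι b) (ι c)) qx≈0
      ^N≈q : ∀ {z} → quadratic (ι b) (ι c) z ≈ 0# → z ^ suc n ≈ ι q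
      ^N≈q qz≈0 = trans (^≈powerRemainder b c qz≈0 (suc n))
                        (trans (+-congʳ (*-≈0ˡ _ (reflexive (≡.cong ι p≡0)))) (+-identityˡ _))
      conjugate : Dec (x' ≈ x) → DegenerateShape f r
      conjugate (no x'≉x)  = inj₂ (quadratic-degenerate b c n qx'≈0 qx≈0 x'≉x
        (x^[1+n]≈y^[1+n]⇒x≉0 n xᴺ≈rᴺ R≉0) (trans (^N≈q qx'≈0) (sym (^N≈q qx≈0))))
      conjugate (yes x'≈x) = root+R≈0⇒shape (cofactor-root⇒root qx≈0)
        (rational∧x^N≈r^N⇒x+r≈0 (+ 2) (ℤ.- b) r n (λ ()) 2x≈-b xᴺ≈rᴺ x≉R) R≉0
        where
        2x≈-b : ι (+ 2) * x ≈ ι (ℤ.- b)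
        2x≈-b = begin
          ι (+ 2) * x         ≈⟨ solve 2 (λ x B → con (+ 2) :* x := (x :- (:- B :- x)) :+ (:- B)) refl x (ι b) ⟩
          (x - x') + - ι b    ≈⟨ +-congʳ (x≈y⇒x-y≈0 (sym x'≈x)) ⟩
          0# + - ι b          ≈⟨ +-identityˡ _ ⟩
          - ι b               ≈⟨ sym (ι-neg b) ⟩
          ι (ℤ.- b)           ∎

    -- Equality in K is undecidable, so the cases are split under a double negation; the
    -- conclusion is a decidable statement about integers, so this costs nothing.
    degenerate⇒¬¬shape : ∀ {α β} n → ¬ α ≈ β → cubic f α ≈ 0# → cubic f β ≈ 0# → ¬ β ≈ 0# →
                         α ^ suc n ≈ β ^ suc n → ¬ ¬ DegenerateShape f r
    degenerate⇒¬¬shape {α} {β} n α≉β fα≈0 fβ≈0 β≉0 αᴺ≈βᴺ ¬shape =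
      ¬¬-excluded-middle λ α≟R → ¬¬-excluded-middle λ β≟R → by-cases α≟R β≟R ¬shape
      where
      by-cases : Dec (α ≈ R) → Dec (β ≈ R) → ¬ ¬ DegenerateShape f r
      by-cases (yes α≈R) _ = cofactor-root∧x^N≈r^N⇒shape n (cofactor-root fβ≈0 β≉R) β≉R
          (trans (sym αᴺ≈βᴺ) (^-congˡ (suc n) α≈R))
          (λ R≈0 → x^[1+n]≈y^[1+n]⇒x≉0 n αᴺ≈βᴺ β≉0 (trans α≈R R≈0))
        where
        β≉R : ¬ β ≈ R
        β≉R β≈R = α≉β (trans α≈R (sym β≈R))
      by-cases (no α≉R) (yes β≈R) = cofactor-root∧x^N≈r^N⇒shape n (cofactor-root fα≈0 α≉R) α≉R
          (trans αᴺ≈βᴺ (^-congˡ (suc n) β≈R)) (λ R≈0 → β≉0 (trans β≈R R≈0))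
      by-cases (no α≉R) (no β≉R) ¬shape = ¬shape (inj₂ (quadratic-degenerate b c n
          (cofactor-root fα≈0 α≉R) (cofactor-root fβ≈0 β≉R) α≉β β≉0 αᴺ≈βᴺ))

open ≡ using (_≡_; _≢_; refl; sym; trans; cong; cong₂; subst; subst₂; module ≡-Reasoning)

-- Reducible cubics have an integer root

natCast[1+n]>0 : ∀ n → 0ℚ ℚ.< natCast ℚP.+-*-commutativeRing (suc n)
natCast[1+n]>0 zero    = ℚP.positive⁻¹ (1ℚ ℚ.+ 0ℚ)
natCast[1+n]>0 (suc n) = ℚP.<-trans (natCast[1+n]>0 zero) (ℚP.+-monoʳ-< 1ℚ (natCast[1+n]>0 n))

ℚ-field : Field0
ℚ-field = record
  { cring      = ℚP.+-*-commutativeRing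
  ; nontrivial = λ ()
  ; inverse    = λ x x≢0 → ℚ.1/_ x {{ℚ.≢-nonZero x≢0}} , ℚP.*-inverseʳ x {{ℚ.≢-nonZero x≢0}}
  ; charZero   = charZero
  }
  where
  charZero : ∀ n → natCast ℚP.+-*-commutativeRing n ≡ 0ℚ → n ≡ 0
  charZero zero    _      = refl
  charZero (suc n) 1+n≡0 = contradiction (sym 1+n≡0) (ℚP.<⇒≢ (natCast[1+n]>0 n))

module _ where
  open FieldTheory ℚ-field

  toℚᵘ-ιℕ : ∀ n → ℚ.toℚᵘ (ιℕ n) ℚᵘ.≃ mkℚᵘ (+ n) 0
  toℚᵘ-ιℕ zero    = ℚᵘP.≃-refl
  toℚᵘ-ιℕ (suc n) = ℚᵘP.≃-trans (ℚP.toℚᵘ-homo-+ 1ℚ (ιℕ n))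
    (ℚᵘP.≃-trans (ℚᵘP.+-cong (ℚᵘP.≃-refl {mkℚᵘ (+ 1) 0}) (toℚᵘ-ιℕ n)) (*≡* (identity (+ n))))
    where
    identity : ∀ x → (1ℤ ℤ.* 1ℤ ℤ.+ x ℤ.* 1ℤ) ℤ.* 1ℤ ≡ (1ℤ ℤ.+ x) ℤ.* (1ℤ ℤ.* 1ℤ)
    identity = ℤSolver.solve-∀

  toℚᵘ-ι : ∀ z → ℚ.toℚᵘ (ι z) ℚᵘ.≃ mkℚᵘ z 0
  toℚᵘ-ι (+ n)    = toℚᵘ-ιℕ n
  toℚᵘ-ι -[1+ n ] = ℚᵘP.≃-trans (ℚP.toℚᵘ-homo‿- (ιℕ (suc n))) (ℚᵘP.-‿cong (toℚᵘ-ιℕ (suc n)))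

  toℚᵘ-/1 : ∀ z → ℚ.toℚᵘ (z ℚ./ 1) ℚᵘ.≃ mkℚᵘ z 0
  toℚᵘ-/1 z = *≡* (begin
    ℚᵘ.↥ (ℚ.toℚᵘ (z ℚ./ 1)) ℤ.* 1ℤ             ≡⟨ cong (ℤ._* 1ℤ) (ℚP.↥ᵘ-toℚᵘ (z ℚ./ 1)) ⟩
    ↥ ℤ.* 1ℤ                                    ≡⟨ cong (↥ ℤ.*_) (sym (ℚP.↧-/ z 1)) ⟩
    ↥ ℤ.* (↧ ℤ.* g)                              ≡⟨ swap ↥ ↧ g ⟩
    (↥ ℤ.* g) ℤ.* ↧                              ≡⟨ cong (ℤ._* ↧) (ℚP.↥-/ z 1) ⟩
    z ℤ.* ↧                                     ≡⟨ cong (z ℤ.*_) (sym (ℚP.↧ᵘ-toℚᵘ (z ℚ./ 1))) ⟩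
    z ℤ.* ℚᵘ.↧ (ℚ.toℚᵘ (z ℚ./ 1))               ∎)
    where
    open ≡-Reasoning
    ↥ = ℚ.↥ (z ℚ./ 1)
    ↧ = ℚ.↧ (z ℚ./ 1)
    g = ℤGCD.gcd z 1ℤ
    swap : ∀ u v g → u ℤ.* (v ℤ.* g) ≡ (u ℤ.* g) ℤ.* v
    swap = ℤSolver.solve-∀

  ι≡/1 : ∀ z → ι z ≡ z ℚ./ 1
  ι≡/1 z = ℚP.toℚᵘ-injective (ℚᵘP.≃-trans (toℚᵘ-ι z) (ℚᵘP.≃-sym (toℚᵘ-/1 z)))

  ι↧*ρ≡ι↥ : ∀ ρ → ι (ℚ.↧ ρ) ℚ.* ρ ≡ ι (ℚ.↥ ρ)
  ι↧*ρ≡ι↥ ρ@(mkℚ n d _) = ℚP.toℚᵘ-injective (ℚᵘP.≃-trans (ℚP.toℚᵘ-homo-* (ι (+ suc d)) ρ)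
    (ℚᵘP.≃-trans (ℚᵘP.*-cong (toℚᵘ-ι (+ suc d)) (ℚᵘP.≃-refl {mkℚᵘ n d}))
    (ℚᵘP.≃-trans (*≡* (identity (+ suc d) n)) (ℚᵘP.≃-sym (toℚᵘ-ι n)))))
    where
    identity : ∀ D n → D ℤ.* n ℤ.* 1ℤ ≡ n ℤ.* (1ℤ ℤ.* D)
    identity = ℤSolver.solve-∀

  rational-root⇒integer-root : ∀ f ρ → cubic f ρ ≡ 0ℚ → ∃[ r ] evalℤ f r ≡ 0ℤ
  rational-root⇒integer-root f ρ@(mkℚ n d coprime) fρ≡0 =
    n , rescaled-root⇒root f n d (Coprimality.sym (Coprimality.recompute coprime)) (ι-injective (begin
      ι (evalℤ (rescale f D) n)     ≡⟨ ι-evalℤ (rescale f D) n ⟩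
      cubic (rescale f D) (ι n)     ≡⟨ cong (cubic (rescale f D)) (sym (ι↧*ρ≡ι↥ ρ)) ⟩
      cubic (rescale f D) (ι D ℚ.* ρ) ≡⟨ cubic-rescale f D ρ ⟩
      ι D ℚ.* ι D ℚ.* ι D ℚ.* cubic f ρ ≡⟨ cong (ι D ℚ.* ι D ℚ.* ι D ℚ.*_) fρ≡0 ⟩
      ι D ℚ.* ι D ℚ.* ι D ℚ.* 0ℚ     ≡⟨ ℚP.*-zeroʳ (ι D ℚ.* ι D ℚ.* ι D) ⟩
      0ℚ                            ∎))
    where
    open ≡-Reasoning
    D = + suc d

  coeffV-beyond : ∀ {d} (v : Vec ℚ (suc d)) i → suc d ℕ.≤ i → coeffV v i ≡ 0ℚ
  coeffV-beyond {d} v i d<i with i ℕ.<? suc d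
  ... | yes i<d = contradiction d<i (ℕP.<⇒≱ i<d)
  ... | no _    = refl

  sumTo-≡0 : ∀ k f → (∀ i → i ℕ.≤ k → f i ≡ 0ℚ) → sumTo k f ≡ 0ℚ
  sumTo-≡0 zero    f f≡0 = f≡0 0 z≤n
  sumTo-≡0 (suc k) f f≡0 = trans (cong₂ ℚ._+_ (sumTo-≡0 k f (λ i i≤k → f≡0 i (ℕP.m≤n⇒m≤1+n i≤k)))
                                              (f≡0 (suc k) ℕP.≤-refl))
                                 (ℚP.+-identityˡ 0ℚ)

  sumTo-single : ∀ k f j → j ℕ.≤ k → (∀ i → i ℕ.≤ k → i ≢ j → f i ≡ 0ℚ) → sumTo k f ≡ f j
  sumTo-single zero    f .zero z≤n _ = refl
  sumTo-single (suc k) f j j≤k f≡0 with j ℕP.≟ suc k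
  ... | yes refl = trans (cong (ℚ._+ f (suc k)) (sumTo-≡0 k f λ i i≤k → f≡0 i (ℕP.m≤n⇒m≤1+n i≤k) (ℕP.<⇒≢ (s≤s i≤k))))
                         (ℚP.+-identityˡ _)
  ... | no j≢k   = trans (cong₂ ℚ._+_ (sumTo-single k f j (ℕP.≤-pred (ℕP.≤∧≢⇒< j≤k j≢k))
                                                    (λ i i≤k → f≡0 i (ℕP.m≤n⇒m≤1+n i≤k)))
                                       (f≡0 (suc k) ℕP.≤-refl (λ k≡j → j≢k (sym k≡j))))
                         (ℚP.+-identityʳ _)

  leading-coeffMul : ∀ d₁ d₂ (g : Vec ℚ (suc d₁)) (h : Vec ℚ (suc d₂)) →
                     coeffMul (coeffV g) (coeffV h) (d₁ ℕ.+ d₂) ≡ coeffV g d₁ ℚ.* coeffV h d₂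
  leading-coeffMul d₁ d₂ g h = trans (sumTo-single (d₁ ℕ.+ d₂) term d₁ (ℕP.m≤m+n d₁ d₂) term≡0)
                                     (cong (λ j → coeffV g d₁ ℚ.* coeffV h j) (ℕP.m+n∸m≡n d₁ d₂))
    where
    term = λ i → coeffV g i ℚ.* coeffV h (d₁ ℕ.+ d₂ ℕ.∸ i)
    term≡0 : ∀ i → i ℕ.≤ d₁ ℕ.+ d₂ → i ≢ d₁ → term i ≡ 0ℚ
    term≡0 i _ i≢d₁ with ℕP.<-cmp i d₁
    ... | tri< i<d₁ _ _ = trans (cong (coeffV g i ℚ.*_) (coeffV-beyond h (d₁ ℕ.+ d₂ ℕ.∸ i) (subst (ℕ._< d₁ ℕ.+ d₂ ℕ.∸ i)
                                  (ℕP.m+n∸m≡n d₁ d₂) (ℕP.∸-monoʳ-< i<d₁ (ℕP.m≤m+n d₁ d₂)))))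
                                (ℚP.*-zeroʳ (coeffV g i))
    ... | tri≈ _ i≡d₁ _ = contradiction i≡d₁ i≢d₁
    ... | tri> _ _ i>d₁ = trans (cong (ℚ._* coeffV h (d₁ ℕ.+ d₂ ℕ.∸ i)) (coeffV-beyond g i i>d₁))
                                (ℚP.*-zeroˡ (coeffV h (d₁ ℕ.+ d₂ ℕ.∸ i)))

  coeffCubic-beyond : ∀ f k → 4 ℕ.≤ k → coeffCubic f k ≡ 0ℚ
  coeffCubic-beyond f _ (s≤s (s≤s (s≤s (s≤s _)))) = refl

  -- The linear factor g₀ + g₁ X has the root -g₀/g₁, and g₁ h₂ = 1 lets us write it -g₀ h₂.
  linear×quadratic⇒root : ∀ f (g₀ g₁ h₀ h₁ h₂ : ℚ) →
    (∀ k → coeffMul (coeffV (g₀ ∷ g₁ ∷ [])) (coeffV (h₀ ∷ h₁ ∷ h₂ ∷ [])) k ≡ coeffCubic f k) →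
    ∃[ ρ ] cubic f ρ ≡ 0ℚ
  linear×quadratic⇒root (a₁ , a₂ , a₃) g₀ g₁ h₀ h₁ h₂ coeffs = ρ , (begin
    ρ ℚ.* ρ ℚ.* ρ ℚ.+ ι a₁ ℚ.* (ρ ℚ.* ρ) ℚ.+ ι a₂ ℚ.* ρ ℚ.+ ι a₃
      ≡⟨ cong₂ (λ u v → ρ ℚ.* ρ ℚ.* ρ ℚ.+ u ℚ.* (ρ ℚ.* ρ) ℚ.+ v ℚ.* ρ ℚ.+ ι a₃)
               (trans (ι≡/1 a₁) (sym (coeffs 2))) (trans (ι≡/1 a₂) (sym (coeffs 1))) ⟩
    _ ≡⟨ cong (λ u → ρ ℚ.* ρ ℚ.* ρ ℚ.+ coeffMul G H 2 ℚ.* (ρ ℚ.* ρ) ℚ.+ coeffMul G H 1 ℚ.* ρ ℚ.+ u)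
              (trans (ι≡/1 a₃) (sym (coeffs 0))) ⟩
    _ ≡⟨ solve 5 (λ g₀ g₁ h₀ h₁ h₂ → let r = :- (g₀ :* h₂) in
           r :* r :* r :+ (g₀ :* h₂ :+ g₁ :* h₁ :+ con 0ℤ :* h₀) :* (r :* r) :+ (g₀ :* h₁ :+ g₁ :* h₀) :* r
             :+ g₀ :* h₀
           := (con 1ℤ :- (g₀ :* con 0ℤ :+ g₁ :* h₂ :+ con 0ℤ :* h₁ :+ con 0ℤ :* h₀))
                :* (g₀ :* (h₀ :+ h₁ :* r :+ h₂ :* (r :* r)) :+ r :* r :* r)) refl g₀ g₁ h₀ h₁ h₂ ⟩
    (1ℚ ℚ.- coeffMul G H 3) ℚ.* Q ≡⟨ cong (λ u → (1ℚ ℚ.- u) ℚ.* Q) (coeffs 3) ⟩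
    (1ℚ ℚ.- 1ℚ) ℚ.* Q             ≡⟨ ℚP.*-zeroˡ Q ⟩
    0ℚ ∎)
    where
    open ≡-Reasoning
    G = coeffV (g₀ ∷ g₁ ∷ [])
    H = coeffV (h₀ ∷ h₁ ∷ h₂ ∷ [])
    ρ = ℚ.- (g₀ ℚ.* h₂)
    Q = g₀ ℚ.* (h₀ ℚ.+ h₁ ℚ.* ρ ℚ.+ h₂ ℚ.* (ρ ℚ.* ρ)) ℚ.+ ρ ℚ.* ρ ℚ.* ρ

  quadratic×linear⇒root : ∀ f (g₀ g₁ g₂ h₀ h₁ : ℚ) →
    (∀ k → coeffMul (coeffV (g₀ ∷ g₁ ∷ g₂ ∷ [])) (coeffV (h₀ ∷ h₁ ∷ [])) k ≡ coeffCubic f k) →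
    ∃[ ρ ] cubic f ρ ≡ 0ℚ
  quadratic×linear⇒root (a₁ , a₂ , a₃) g₀ g₁ g₂ h₀ h₁ coeffs = ρ , (begin
    ρ ℚ.* ρ ℚ.* ρ ℚ.+ ι a₁ ℚ.* (ρ ℚ.* ρ) ℚ.+ ι a₂ ℚ.* ρ ℚ.+ ι a₃
      ≡⟨ cong₂ (λ u v → ρ ℚ.* ρ ℚ.* ρ ℚ.+ u ℚ.* (ρ ℚ.* ρ) ℚ.+ v ℚ.* ρ ℚ.+ ι a₃)
               (trans (ι≡/1 a₁) (sym (coeffs 2))) (trans (ι≡/1 a₂) (sym (coeffs 1))) ⟩
    _ ≡⟨ cong (λ u → ρ ℚ.* ρ ℚ.* ρ ℚ.+ coeffMul G H 2 ℚ.* (ρ ℚ.* ρ) ℚ.+ coeffMul G H 1 ℚ.* ρ ℚ.+ u)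
              (trans (ι≡/1 a₃) (sym (coeffs 0))) ⟩
    _ ≡⟨ solve 5 (λ g₀ g₁ g₂ h₀ h₁ → let r = :- (h₀ :* g₂) in
           r :* r :* r :+ (g₀ :* con 0ℤ :+ g₁ :* h₁ :+ g₂ :* h₀) :* (r :* r) :+ (g₀ :* h₁ :+ g₁ :* h₀) :* r
             :+ g₀ :* h₀
           := (con 1ℤ :- (g₀ :* con 0ℤ :+ g₁ :* con 0ℤ :+ g₂ :* h₁ :+ con 0ℤ :* h₀))
                :* (h₀ :* (g₀ :+ g₁ :* r :+ g₂ :* (r :* r)) :+ r :* r :* r)) refl g₀ g₁ g₂ h₀ h₁ ⟩
    (1ℚ ℚ.- coeffMul G H 3) ℚ.* Q ≡⟨ cong (λ u → (1ℚ ℚ.- u) ℚ.* Q) (coeffs 3) ⟩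
    (1ℚ ℚ.- 1ℚ) ℚ.* Q             ≡⟨ ℚP.*-zeroˡ Q ⟩
    0ℚ ∎)
    where
    open ≡-Reasoning
    G = coeffV (g₀ ∷ g₁ ∷ g₂ ∷ [])
    H = coeffV (h₀ ∷ h₁ ∷ [])
    ρ = ℚ.- (h₀ ℚ.* g₂)
    Q = h₀ ℚ.* (g₀ ℚ.+ g₁ ℚ.* ρ ℚ.+ g₂ ℚ.* (ρ ℚ.* ρ)) ℚ.+ ρ ℚ.* ρ ℚ.* ρ

  linear×linear≢cubic : ∀ f (g₀ g₁ h₀ h₁ : ℚ) →
    coeffMul (coeffV (g₀ ∷ g₁ ∷ [])) (coeffV (h₀ ∷ h₁ ∷ [])) 3 ≢ coeffCubic f 3
  linear×linear≢cubic f g₀ g₁ h₀ h₁ coeff₃ = contradiction (trans (sym coeff₃) vanishes) λ ()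
    where
    vanishes : coeffMul (coeffV (g₀ ∷ g₁ ∷ [])) (coeffV (h₀ ∷ h₁ ∷ [])) 3 ≡ 0ℚ
    vanishes = solve 4 (λ g₀ g₁ h₀ h₁ →
      g₀ :* con 0ℤ :+ g₁ :* con 0ℤ :+ con 0ℤ :* h₁ :+ con 0ℤ :* h₀ := con 0ℤ) refl g₀ g₁ h₀ h₁

  factor-degrees : ∀ f d₁ d₂ (g : Vec ℚ (suc (suc d₁))) (h : Vec ℚ (suc (suc d₂))) →
                   coeffV g (suc d₁) ≢ 0ℚ → coeffV h (suc d₂) ≢ 0ℚ →
                   (∀ k → coeffMul (coeffV g) (coeffV h) k ≡ coeffCubic f k) → d₁ ℕ.+ d₂ ℕ.≤ 1
  factor-degrees f d₁ d₂ g h g≢0 h≢0 coeffs with d₁ ℕ.+ d₂ ℕP.≤? 1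
  ... | yes d₁+d₂≤1 = d₁+d₂≤1
  ... | no  d₁+d₂≰1 = contradiction leading≡0 (*-≉0 g≢0 h≢0)
    where
    4≤deg : 4 ℕ.≤ suc d₁ ℕ.+ suc d₂
    4≤deg = subst (4 ℕ.≤_) (cong suc (sym (ℕP.+-suc d₁ d₂))) (s≤s (s≤s (ℕP.≰⇒> d₁+d₂≰1)))
    leading≡0 : coeffV g (suc d₁) ℚ.* coeffV h (suc d₂) ≡ 0ℚ
    leading≡0 = trans (sym (leading-coeffMul (suc d₁) (suc d₂) g h))
                      (trans (coeffs (suc d₁ ℕ.+ suc d₂)) (coeffCubic-beyond f _ 4≤deg))

  reducible⇒rational-root : ∀ f → ReducibleQ f → ∃[ ρ ] cubic f ρ ≡ 0ℚ
  reducible⇒rational-root f (d₁ , d₂ , g , h , g≢0 , h≢0 , coeffs) =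
    by-degrees d₁ d₂ g h coeffs (factor-degrees f d₁ d₂ g h g≢0 h≢0 coeffs)
    where
    by-degrees : ∀ d₁ d₂ (g : Vec ℚ (suc (suc d₁))) (h : Vec ℚ (suc (suc d₂))) →
                 (∀ k → coeffMul (coeffV g) (coeffV h) k ≡ coeffCubic f k) → d₁ ℕ.+ d₂ ℕ.≤ 1 →
                 ∃[ ρ ] cubic f ρ ≡ 0ℚ
    by-degrees 0 0 (g₀ ∷ g₁ ∷ []) (h₀ ∷ h₁ ∷ []) coeffs _ =
      contradiction (coeffs 3) (linear×linear≢cubic f g₀ g₁ h₀ h₁)
    by-degrees 0 1 (g₀ ∷ g₁ ∷ []) (h₀ ∷ h₁ ∷ h₂ ∷ []) coeffs _ = linear×quadratic⇒root f g₀ g₁ h₀ h₁ h₂ coeffs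
    by-degrees 1 0 (g₀ ∷ g₁ ∷ g₂ ∷ []) (h₀ ∷ h₁ ∷ []) coeffs _ = quadratic×linear⇒root f g₀ g₁ g₂ h₀ h₁ coeffs
    by-degrees 0             (suc (suc _)) _ _ _ (s≤s ())
    by-degrees 1             (suc _)       _ _ _ (s≤s ())
    by-degrees (suc (suc _)) _             _ _ _ (s≤s ())

-- Lattice points under a hyperbola

open import Data.Nat using (_+_; _*_; _^_; _≤_; _<_)

module _ {A : Set} where

  ∈-─ : ∀ {x y : A} {ys} (x∈ys : x ∈ ys) → y ∈ ys → y ≢ x → y ∈ (ys ─ x∈ys)
  ∈-─ (here refl) (here refl) y≢x = contradiction refl y≢x
  ∈-─ (here refl) (there y∈ys) _  = y∈ys
  ∈-─ (there _)   (here y≡z)   _  = here y≡z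
  ∈-─ (there x∈ys) (there y∈ys) y≢x = there (∈-─ x∈ys y∈ys y≢x)

  Unique∧⊆⇒length≤ : ∀ {xs ys : List A} → Unique xs → xs ⊆ ys → length xs ≤ length ys
  Unique∧⊆⇒length≤ {[]}     _                 _      = z≤n
  Unique∧⊆⇒length≤ {x ∷ xs} {ys} (x∉xs ∷ unique) xs⊆ys =
    subst (suc (length xs) ≤_) (sym (List.length-removeAt′ ys _))
      (s≤s (Unique∧⊆⇒length≤ unique λ y∈xs → ∈-─ x∈ys (xs⊆ys (there y∈xs)) λ y≡x → All.lookup x∉xs y∈xs (sym y≡x)))
    where
    x∈ys = xs⊆ys (here refl)

length-cartesianProductWith : ∀ {A B C : Set} (f : A → B → C) xs ys →
                              length (cartesianProductWith f xs ys) ≡ length xs * length ys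
length-cartesianProductWith f []       ys = refl
length-cartesianProductWith f (x ∷ xs) ys = trans (List.length-++ (map (f x) ys))
  (cong₂ _+_ (List.length-map (f x) ys) (length-cartesianProductWith f xs ys))

interval : ℕ → List ℤ
interval Y = map +_ (upTo (suc Y)) ++ map -[1+_] (upTo Y)

length-interval : ∀ Y → length (interval Y) ≡ suc (Y + Y)
length-interval Y = trans (List.length-++ (map +_ (upTo (suc Y))))
  (cong₂ _+_ (trans (List.length-map +_ (upTo (suc Y))) (List.length-upTo (suc Y)))
             (trans (List.length-map -[1+_] (upTo Y)) (List.length-upTo Y)))

∈-interval : ∀ {Y} y → ∣ y ∣ ≤ Y → y ∈ interval Y
∈-interval {Y} (+ n)    n≤Y   = ∈-++⁺ˡ (∈-map⁺ +_ (∈-upTo⁺ (s≤s n≤Y)))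
∈-interval {Y} -[1+ n ] 1+n≤Y = ∈-++⁺ʳ (map +_ (upTo (suc Y))) (∈-map⁺ -[1+_] (∈-upTo⁺ 1+n≤Y))

-- Covers the lattice points (x , y) with |x| < 2^K under the hyperbola |x y| ≤ M: the line x = 0,
-- and for each j < K the box |x| ≤ 2^(j+1), |y| ≤ M / 2^j.
hyperbolaCover : ℕ → ℕ → List (ℤ × ℤ)
hyperbolaCover M zero    = cartesianProduct (0ℤ ∷ []) (interval M)
hyperbolaCover M (suc j) = cartesianProduct (interval (2 ^ suc j)) (interval (M / 2 ^ j)) ++ hyperbolaCover M j
  where instance _ = ℕP.m^n≢0 2 j

∈-hyperbolaCover : ∀ M K x y → ∣ x ∣ < 2 ^ K → ∣ y ∣ ≤ M → ∣ x ℤ.* y ∣ ≤ M → (x , y) ∈ hyperbolaCover M K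
∈-hyperbolaCover M zero    (+ 0)           y _ ∣y∣≤M _ =
  ∈-cartesianProduct⁺ {xs = 0ℤ ∷ []} (here refl) (∈-interval y ∣y∣≤M)
∈-hyperbolaCover M zero    (+ suc _)       y (s≤s ()) _ _
∈-hyperbolaCover M zero    -[1+ _ ]        y (s≤s ()) _ _
∈-hyperbolaCover M (suc K) x y ∣x∣<2^[1+K] ∣y∣≤M ∣xy∣≤M = by-size (∣ x ∣ ℕP.<? 2 ^ K)
  where
  instance _ = ℕP.m^n≢0 2 K
  by-size : Dec (∣ x ∣ < 2 ^ K) → (x , y) ∈ hyperbolaCover M (suc K)
  by-size (yes ∣x∣<2^K) = ∈-++⁺ʳ (cartesianProduct (interval (2 ^ suc K)) (interval (M / 2 ^ K)))
                                 (∈-hyperbolaCover M K x y ∣x∣<2^K ∣y∣≤M ∣xy∣≤M)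
  by-size (no  ∣x∣≮2^K) = ∈-++⁺ˡ (∈-cartesianProduct⁺ (∈-interval x (ℕP.<⇒≤ ∣x∣<2^[1+K]))
                                                      (∈-interval y ∣y∣≤M/2^K))
    where
    2^K*∣y∣≤M : 2 ^ K * ∣ y ∣ ≤ M
    2^K*∣y∣≤M = ℕP.≤-trans (ℕP.*-monoˡ-≤ ∣ y ∣ (ℕP.≮⇒≥ ∣x∣≮2^K))
                           (subst (_≤ M) (ℤP.∣i*j∣≡∣i∣*∣j∣ x y) ∣xy∣≤M)
    ∣y∣≤M/2^K : ∣ y ∣ ≤ M / 2 ^ K
    ∣y∣≤M/2^K = subst (_≤ M / 2 ^ K) (m*n/n≡m ∣ y ∣ (2 ^ K))
                      (/-monoˡ-≤ (2 ^ K) (subst (_≤ M) (ℕP.*-comm (2 ^ K) ∣ y ∣) 2^K*∣y∣≤M))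

length-hyperbolaBox : ∀ M j → 2 ^ j ≤ M → let instance _ = ℕP.m^n≢0 2 j in
                      length (cartesianProduct (interval (2 ^ suc j)) (interval (M / 2 ^ j))) ≤ 15 * M
length-hyperbolaBox M j 2^j≤M = begin
  length (cartesianProduct (interval (2 ^ suc j)) (interval Y))
    ≡⟨ length-cartesianProductWith _,_ (interval (2 ^ suc j)) (interval Y) ⟩
  length (interval (2 ^ suc j)) * length (interval Y)
    ≡⟨ cong₂ _*_ (length-interval (2 ^ suc j)) (length-interval Y) ⟩
  suc (2 * p + 2 * p) * suc (Y + Y)
    ≡⟨ expand p Y ⟩
  8 * (Y * p) + 4 * p + 2 * Y + 1
    ≤⟨ ℕP.+-mono-≤ (ℕP.+-mono-≤ (ℕP.+-mono-≤ (ℕP.*-monoʳ-≤ 8 (m/n*n≤m M p)) (ℕP.*-monoʳ-≤ 4 2^j≤M))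
                                 (ℕP.*-monoʳ-≤ 2 (m/n≤m M p)))
                   (ℕP.≤-trans (ℕP.m^n>0 2 j) 2^j≤M) ⟩
  8 * M + 4 * M + 2 * M + M
    ≡⟨ collect M ⟩
  15 * M ∎
  where
  open ℕP.≤-Reasoning
  instance _ = ℕP.m^n≢0 2 j
  p = 2 ^ j
  Y = M / p
  expand : ∀ p Y → suc (2 * p + 2 * p) * suc (Y + Y) ≡ 8 * (Y * p) + 4 * p + 2 * Y + 1
  expand = ℕSolver.solve-∀
  collect : ∀ M → 8 * M + 4 * M + 2 * M + M ≡ 15 * M
  collect = ℕSolver.solve-∀

length-hyperbolaCover : ∀ M K → 2 ^ K ≤ 2 * M → length (hyperbolaCover M K) ≤ suc (M + M) + K * (15 * M)
length-hyperbolaCover M zero    _ = ℕP.≤-reflexive (trans (length-cartesianProductWith _,_ (0ℤ ∷ []) (interval M))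
  (trans (ℕP.+-identityʳ _) (trans (length-interval M) (sym (ℕP.+-identityʳ _)))))
length-hyperbolaCover M (suc K) 2^[1+K]≤2M = begin
  length (box ++ hyperbolaCover M K)                  ≡⟨ List.length-++ box ⟩
  length box + length (hyperbolaCover M K)            ≤⟨ ℕP.+-mono-≤ (length-hyperbolaBox M K 2^K≤M)
                                                           (length-hyperbolaCover M K (ℕP.≤-trans 2^K≤M (ℕP.m≤n*m M 2))) ⟩
  15 * M + (suc (M + M) + K * (15 * M))               ≡⟨ shuffle (15 * M) (suc (M + M)) (K * (15 * M)) ⟩
  suc (M + M) + suc K * (15 * M)                      ∎
  where
  open ℕP.≤-Reasoning
  instance _ = ℕP.m^n≢0 2 K
  box = cartesianProduct (interval (2 ^ suc K)) (interval (M / 2 ^ K))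
  2^K≤M : 2 ^ K ≤ M
  2^K≤M = ℕP.*-cancelˡ-≤ 2 2^[1+K]≤2M
  shuffle : ∀ a b c → a + (b + c) ≡ b + (a + c)
  shuffle = ℕSolver.solve-∀

-- Counting

degenerate∧reducible⇒shape : ∀ f → Degenerate f → ReducibleQ f → ∃[ r ] evalℤ f r ≡ 0ℤ × DegenerateShape f r
degenerate∧reducible⇒shape f (K , α , β , α≉β , fα≈0 , fβ≈0 , β≉0 , suc n , _ , αᴺ≈βᴺ) reducible =
  let (ρ , fρ≡0) = reducible⇒rational-root f reducible
      (r , fr≡0) = rational-root⇒integer-root f ρ fρ≡0
  in  r , fr≡0 , decidable-stable (degenerateShape? f r)
        (FieldTheory.degenerate⇒¬¬shape K f r fr≡0 n α≉β (onCubic fα≈0) (onCubic fβ≈0) β≉0 αᴺ≈βᴺ)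
  where
  open Field0 K using (_≈_; 0#)
  onCubic : ∀ {x} → evalCubic K f x ≈ 0# → FieldTheory.cubic K f x ≈ 0#
  onCubic {x} fx≈0 = Field0.trans K (Field0.sym K (FieldTheory.evalCubic≈cubic K f x)) fx≈0

-- (X + a₁) (X² + a₂)
productCubic : ℤ × ℤ → Cubic
productCubic (a₁ , a₂) = a₁ , a₂ , a₁ ℤ.* a₂

-- (X - r) (X² + b X + c) with c = b² / k, the division being exact where it is used
shapedCubic : (k : ℕ) .{{_ : ℕ.NonZero k}} → ℤ × ℤ → Cubic
shapedCubic k (r , b) = b ℤ.- r , c ℤ.- r ℤ.* b , ℤ.- (r ℤ.* c)
  where c = + (∣ b ∣ * ∣ b ∣ / k)

families : List (ℤ × ℤ → Cubic)
families = productCubic ∷ shapedCubic 1 ∷ shapedCubic 2 ∷ shapedCubic 3 ∷ []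

candidates : ℕ → ℕ → List Cubic
candidates M K = cartesianProductWith id families (hyperbolaCover M K)

length-candidates : ∀ M K → length (candidates M K) ≡ 4 * length (hyperbolaCover M K)
length-candidates M K = length-cartesianProductWith id families (hyperbolaCover M K)

root⇒a₃≡-rc : ∀ a₁ a₂ a₃ r → evalℤ (a₁ , a₂ , a₃) r ≡ 0ℤ → a₃ ≡ ℤ.- (r ℤ.* proj₂ (cofactor (a₁ , a₂ , a₃) r))
root⇒a₃≡-rc a₁ a₂ a₃ r fr≡0 = trans (expand a₁ a₂ a₃ r) (trans (cong (ℤ._- _) fr≡0) (ℤP.+-identityˡ _))
  where
  expand : ∀ a₁ a₂ a₃ r → a₃ ≡ (r ℤ.* r ℤ.* r ℤ.+ a₁ ℤ.* (r ℤ.* r) ℤ.+ a₂ ℤ.* r ℤ.+ a₃)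
                                 ℤ.- r ℤ.* (a₂ ℤ.+ r ℤ.* (a₁ ℤ.+ r))
  expand = ℤSolver.solve-∀

i*i≡+∣i∣*∣i∣ : ∀ i → i ℤ.* i ≡ + (∣ i ∣ * ∣ i ∣)
i*i≡+∣i∣*∣i∣ (+ n)    = ℤP.+◃n≡+n (n * n)
i*i≡+∣i∣*∣i∣ -[1+ n ] = ℤP.+◃n≡+n (suc n * suc n)

b*b≡k*c⇒c≡b²/k : ∀ k .{{_ : ℕ.NonZero k}} b c → b ℤ.* b ≡ + k ℤ.* c → + (∣ b ∣ * ∣ b ∣ / k) ≡ c
b*b≡k*c⇒c≡b²/k k b (+ m) b²≡kc = cong +_ (trans (cong (_/ k) (trans ∣b∣²≡km (ℕP.*-comm k m))) (m*n/n≡m m k))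
  where
  ∣b∣²≡km : ∣ b ∣ * ∣ b ∣ ≡ k * m
  ∣b∣²≡km = trans (sym (ℤP.∣i*j∣≡∣i∣*∣j∣ b b)) (trans (cong ∣_∣ b²≡kc) (ℤP.∣i*j∣≡∣i∣*∣j∣ (+ k) (+ m)))
b*b≡k*c⇒c≡b²/k (suc k) b -[1+ m ] b²≡kc with trans (sym (i*i≡+∣i∣*∣i∣ b)) b²≡kc
... | ()

m≤m*n⊎n≡0 : ∀ m n → m ≤ m * n ⊎ n ≡ 0
m≤m*n⊎n≡0 m zero    = inj₂ refl
m≤m*n⊎n≡0 m (suc n) = inj₁ (ℕP.m≤m*n m (suc n))

module _ {H K : ℕ} (3H<2ᴷ : 3 * H < 2 ^ K) where

  private
    H≤3H : H ≤ 3 * H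
    H≤3H = ℕP.m≤n*m H 3

  ∈-candidates : ∀ {family} x y → family ∈ families → ∣ x ∣ ≤ 3 * H → ∣ y ∣ ≤ 3 * H →
                 ∣ x ℤ.* y ∣ ≤ 3 * H → family (x , y) ∈ candidates (3 * H) K
  ∈-candidates x y family∈ ∣x∣≤ ∣y∣≤ ∣xy∣≤ =
    ∈-cartesianProductWith⁺ id family∈ (∈-hyperbolaCover (3 * H) K x y (ℕP.≤-<-trans ∣x∣≤ 3H<2ᴷ) ∣y∣≤ ∣xy∣≤)

  shape⇒∈candidates : ∀ f r → Bounded H f → evalℤ f r ≡ 0ℤ → DegenerateShape f r → f ∈ candidates (3 * H) K
  shape⇒∈candidates f@(a₁ , a₂ , a₃) r (∣a₁∣≤H , ∣a₂∣≤H , ∣a₃∣≤H) fr≡0 = by-shape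
    where
    b = a₁ ℤ.+ r
    c = a₂ ℤ.+ r ℤ.* b
    a₃≡-rc : a₃ ≡ ℤ.- (r ℤ.* c)
    a₃≡-rc = root⇒a₃≡-rc a₁ a₂ a₃ r fr≡0
    a₁≡b-r : a₁ ≡ b ℤ.- r
    a₁≡b-r = cancel a₁ r
      where
      cancel : ∀ a₁ r → a₁ ≡ a₁ ℤ.+ r ℤ.- r
      cancel = ℤSolver.solve-∀

    product : a₃ ≡ a₁ ℤ.* a₂ → f ∈ candidates (3 * H) K
    product a₃≡a₁a₂ = subst (λ z → (a₁ , a₂ , z) ∈ candidates (3 * H) K) (sym a₃≡a₁a₂)
      (∈-candidates a₁ a₂ (here refl) (ℕP.≤-trans ∣a₁∣≤H H≤3H) (ℕP.≤-trans ∣a₂∣≤H H≤3H)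
        (ℕP.≤-trans (subst (_≤ H) (cong ∣_∣ a₃≡a₁a₂) ∣a₃∣≤H) H≤3H))

    b≡0⇒a₃≡a₁a₂ : b ≡ 0ℤ → a₃ ≡ a₁ ℤ.* a₂
    b≡0⇒a₃≡a₁a₂ b≡0 = trans a₃≡-rc (trans (cong (λ u → ℤ.- (r ℤ.* (a₂ ℤ.+ r ℤ.* u))) b≡0)
      (trans (identity r a₂) (cong (ℤ._* a₂) (sym (trans a₁≡b-r (cong (ℤ._- r) b≡0))))))
      where
      identity : ∀ r a₂ → ℤ.- (r ℤ.* (a₂ ℤ.+ r ℤ.* 0ℤ)) ≡ (0ℤ ℤ.- r) ℤ.* a₂
      identity = ℤSolver.solve-∀

    shaped : ∀ k .{{_ : ℕ.NonZero k}} {family} → family ∈ families → family ≡ shapedCubic k → k ≤ 3 →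
             b ℤ.* b ≡ + k ℤ.* c → f ∈ candidates (3 * H) K
    shaped k family∈ refl k≤3 b²≡kc = subst (_∈ candidates (3 * H) K) f≡
        (∈-candidates r b family∈ ∣r∣≤3H ∣b∣≤3H (subst (_≤ 3 * H) (sym (ℤP.∣i*j∣≡∣i∣*∣j∣ r b)) ∣r∣∣b∣≤3H))
      where
      ∣r∣∣c∣≤H : ∣ r ∣ * ∣ c ∣ ≤ H
      ∣r∣∣c∣≤H = subst (_≤ H) (trans (cong ∣_∣ a₃≡-rc) (trans (ℤP.∣-i∣≡∣i∣ (r ℤ.* c)) (ℤP.∣i*j∣≡∣i∣*∣j∣ r c))) ∣a₃∣≤H
      ∣b∣²≡k∣c∣ : ∣ b ∣ * ∣ b ∣ ≡ k * ∣ c ∣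
      ∣b∣²≡k∣c∣ = trans (sym (ℤP.∣i*j∣≡∣i∣*∣j∣ b b)) (trans (cong ∣_∣ b²≡kc) (ℤP.∣i*j∣≡∣i∣*∣j∣ (+ k) c))
      ∣r∣∣b∣≤3H : ∣ r ∣ * ∣ b ∣ ≤ 3 * H
      ∣r∣∣b∣≤3H with m≤m*n⊎n≡0 ∣ b ∣ ∣ b ∣
      ... | inj₂ ∣b∣≡0 = subst (_≤ 3 * H) (sym (trans (cong (∣ r ∣ *_) ∣b∣≡0) (ℕP.*-zeroʳ ∣ r ∣))) z≤n
      ... | inj₁ ∣b∣≤∣b∣² = begin
        R * B          ≤⟨ ℕP.*-monoʳ-≤ R ∣b∣≤∣b∣² ⟩
        R * (B * B)    ≡⟨ cong (R *_) ∣b∣²≡k∣c∣ ⟩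
        R * (k * C)    ≡⟨ swap R k C ⟩
        k * (R * C)    ≤⟨ ℕP.*-mono-≤ k≤3 ∣r∣∣c∣≤H ⟩
        3 * H          ∎
        where
        open ℕP.≤-Reasoning
        R = ∣ r ∣
        B = ∣ b ∣
        C = ∣ c ∣
        swap : ∀ x y z → x * (y * z) ≡ y * (x * z)
        swap = ℕSolver.solve-∀
      ∣b∣≤3H : ∣ b ∣ ≤ 3 * H
      ∣b∣≤3H with m≤m*n⊎n≡0 ∣ b ∣ ∣ r ∣
      ... | inj₁ ∣b∣≤∣b∣∣r∣ = ℕP.≤-trans ∣b∣≤∣b∣∣r∣ (subst (_≤ 3 * H) (ℕP.*-comm ∣ r ∣ ∣ b ∣) ∣r∣∣b∣≤3H)
      ... | inj₂ ∣r∣≡0 = ℕP.≤-trans (subst (_≤ H) (cong ∣_∣ a₁≡b) ∣a₁∣≤H) H≤3H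
        where
        a₁≡b : a₁ ≡ b
        a₁≡b = sym (trans (cong (λ u → a₁ ℤ.+ u) (ℤP.∣i∣≡0⇒i≡0 ∣r∣≡0)) (ℤP.+-identityʳ a₁))
      ∣r∣≤3H : ∣ r ∣ ≤ 3 * H
      ∣r∣≤3H with m≤m*n⊎n≡0 ∣ r ∣ ∣ b ∣
      ... | inj₁ ∣r∣≤∣r∣∣b∣ = ℕP.≤-trans ∣r∣≤∣r∣∣b∣ ∣r∣∣b∣≤3H
      ... | inj₂ ∣b∣≡0 = ℕP.≤-trans (subst (_≤ H) ∣a₁∣≡∣r∣ ∣a₁∣≤H) H≤3H
        where
        ∣a₁∣≡∣r∣ : ∣ a₁ ∣ ≡ ∣ r ∣
        ∣a₁∣≡∣r∣ = begin
          ∣ a₁ ∣           ≡⟨ cong ∣_∣ a₁≡b-r ⟩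
          ∣ b ℤ.- r ∣      ≡⟨ cong (λ u → ∣ u ℤ.- r ∣) (ℤP.∣i∣≡0⇒i≡0 {b} ∣b∣≡0) ⟩
          ∣ 0ℤ ℤ.- r ∣     ≡⟨ cong ∣_∣ (ℤP.+-identityˡ (ℤ.- r)) ⟩
          ∣ ℤ.- r ∣        ≡⟨ ℤP.∣-i∣≡∣i∣ r ⟩
          ∣ r ∣            ∎
          where open ≡-Reasoning
      f≡ : shapedCubic k (r , b) ≡ f
      f≡ = cong₂ _,_ (sym a₁≡b-r) (cong₂ _,_
        (trans (cong (ℤ._- r ℤ.* b) c≡) (cancel a₂ (r ℤ.* b)))
        (trans (cong (λ u → ℤ.- (r ℤ.* u)) c≡) (sym a₃≡-rc)))
        where
        c≡ = b*b≡k*c⇒c≡b²/k k b c b²≡kc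
        cancel : ∀ a₂ x → a₂ ℤ.+ x ℤ.- x ≡ a₂
        cancel = ℤSolver.solve-∀

    by-shape : DegenerateShape f r → f ∈ candidates (3 * H) K
    by-shape (inj₁ a₃≡a₁a₂)        = product a₃≡a₁a₂
    by-shape (inj₂ (zero , b²≡0c)) = product (b≡0⇒a₃≡a₁a₂ ([ id , id ]′ (ℤP.i*j≡0⇒i≡0∨j≡0 b b²≡0c)))
    by-shape (inj₂ (suc zero , b²≡c)) =
      shaped 1 (there (here refl)) refl (s≤s z≤n) b²≡c
    by-shape (inj₂ (suc (suc zero) , b²≡2c)) =
      shaped 2 (there (there (here refl))) refl (s≤s (s≤s z≤n)) b²≡2c
    by-shape (inj₂ (suc (suc (suc zero)) , b²≡3c)) =
      shaped 3 (there (there (there (here refl)))) refl ℕP.≤-refl b²≡3c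

  counted⇒∈candidates : ∀ {f} → CountedR3 H f → f ∈ candidates (3 * H) K
  counted⇒∈candidates {f} (bounded , degenerate , reducible) =
    let (r , fr≡0 , shape) = degenerate∧reducible⇒shape f degenerate reducible
    in  shape⇒∈candidates f r bounded fr≡0 shape

dyadic-scale : ∀ n → 1 ≤ n → ∃[ k ] 2 ^ k ≤ n × n < 2 ^ suc k
dyadic-scale (suc zero)    _ = 0 , s≤s z≤n , s≤s (s≤s z≤n)
dyadic-scale (suc (suc m)) _ with dyadic-scale (suc m) (s≤s z≤n)
... | k , 2ᵏ≤n , n<2ᵏ⁺¹ with suc (suc m) ℕP.<? 2 ^ suc k
...   | yes n+1<2ᵏ⁺¹ = k , ℕP.m≤n⇒m≤1+n 2ᵏ≤n , n+1<2ᵏ⁺¹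
...   | no  n+1≮2ᵏ⁺¹ = suc k , ℕP.≮⇒≥ n+1≮2ᵏ⁺¹ ,
                       ℕP.≤-<-trans n<2ᵏ⁺¹ (ℕP.^-monoʳ-< 2 (s≤s (s≤s z≤n)) (ℕP.n<1+n (suc k)))

⌊log₂4n⌋≡2+⌊log₂n⌋ : ∀ n .{{_ : ℕ.NonZero n}} → ⌊log₂ (4 * n) ⌋ ≡ 2 + ⌊log₂ n ⌋
⌊log₂4n⌋≡2+⌊log₂n⌋ n = trans (cong ⌊log₂_⌋ (ℕP.*-assoc 2 2 n))
  (trans (⌊log₂[2*b]⌋≡1+⌊log₂b⌋ (2 * n) {{ℕP.m*n≢0 2 n}}) (cong suc (⌊log₂[2*b]⌋≡1+⌊log₂b⌋ n)))

length-candidates≤ : ∀ H k → 2 ≤ H → 2 ^ k ≤ 3 * H → length (candidates (3 * H) (suc k)) ≤ 748 * H * ⌊log₂ H ⌋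
length-candidates≤ H k 2≤H 2ᵏ≤3H = begin
  length (candidates M (suc k))                       ≡⟨ length-candidates M (suc k) ⟩
  4 * length (hyperbolaCover M (suc k))               ≤⟨ ℕP.*-monoʳ-≤ 4 (length-hyperbolaCover M (suc k) 2ᵏ⁺¹≤2M) ⟩
  4 * (suc (M + M) + suc k * (15 * M))                ≤⟨ ℕP.*-monoʳ-≤ 4 (ℕP.+-mono-≤ 1+6H≤7Hlg
                                                          (ℕP.*-monoˡ-≤ (15 * M) 1+k≤4lg)) ⟩
  4 * (7 * (H * lg) + 4 * lg * (15 * (3 * H)))        ≡⟨ collect H lg ⟩
  748 * H * lg                                        ∎
  where
  open ℕP.≤-Reasoning
  M = 3 * H
  lg = ⌊log₂ H ⌋
  instance
    H≢0 : ℕ.NonZero H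
    H≢0 = ℕ.>-nonZero (ℕP.<-≤-trans (s≤s z≤n) 2≤H)
  1≤lg : 1 ≤ lg
  1≤lg = ⌊log₂⌋-mono-≤ 2≤H
  2ᵏ⁺¹≤2M : 2 ^ suc k ≤ 2 * M
  2ᵏ⁺¹≤2M = ℕP.*-monoʳ-≤ 2 2ᵏ≤3H
  k≤2+lg : k ≤ 2 + lg
  k≤2+lg = subst₂ _≤_ (⌊log₂[2^n]⌋≡n k) (⌊log₂4n⌋≡2+⌊log₂n⌋ H)
                     (⌊log₂⌋-mono-≤ (ℕP.≤-trans 2ᵏ≤3H (ℕP.*-monoˡ-≤ H (ℕP.n≤1+n 3))))
  1+k≤4lg : suc k ≤ 4 * lg
  1+k≤4lg = ℕP.≤-trans (s≤s k≤2+lg)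
    (subst (3 + lg ≤_) (ℕP.+-comm (3 * lg) lg) (ℕP.+-monoˡ-≤ lg (ℕP.*-monoʳ-≤ 3 1≤lg)))
  1+6H≤7Hlg : suc (M + M) ≤ 7 * (H * lg)
  1+6H≤7Hlg = ℕP.≤-trans (subst (suc (M + M) ≤_) (sevenfold H) (ℕP.+-monoˡ-≤ (M + M) (ℕP.<-≤-trans (s≤s z≤n) 2≤H)))
    (ℕP.*-monoʳ-≤ 7 (ℕP.m≤m*n H lg {{ℕ.>-nonZero 1≤lg}}))
    where
    sevenfold : ∀ H → H + (3 * H + 3 * H) ≡ 7 * H
    sevenfold = ℕSolver.solve-∀
  collect : ∀ H l → 4 * (7 * (H * l) + 4 * l * (15 * (3 * H))) ≡ 748 * H * l
  collect = ℕSolver.solve-∀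

proposition4p3 : ∃[ C ] (1 ≤ C × (∀ (H : ℕ) → 2 ≤ H → (fs : List Cubic) →
    Unique fs → All (CountedR3 H) fs → length fs ≤ C * H * ⌊log₂ H ⌋))
proposition4p3 = 748 , s≤s z≤n , bound
  where
  bound : ∀ H → 2 ≤ H → (fs : List Cubic) → Unique fs → All (CountedR3 H) fs →
          length fs ≤ 748 * H * ⌊log₂ H ⌋
  bound H 2≤H fs unique counted =
    let (k , 2ᵏ≤3H , 3H<2ᵏ⁺¹) = dyadic-scale (3 * H) (ℕP.≤-trans (s≤s z≤n) (ℕP.≤-trans 2≤H (ℕP.m≤n*m H 3)))
    in  ℕP.≤-trans (Unique∧⊆⇒length≤ unique λ f∈fs →
                      counted⇒∈candidates {H} {suc k} 3H<2ᵏ⁺¹ (All.lookup counted f∈fs))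
                   (length-candidates≤ H k 2≤H 2ᵏ≤3H)
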